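{- Let $n\ge3$ and let $(h_{n,0},h_{n,1},\dots,h_{n,\lfloor\frac{n-1}{2}\rfloor})$ be the h-vector of $\mathcal P_n$. Then $$\begin{cases}h_{n+1,0}=h_{n,0},\\ h_{n+1,i}=h_{n,i}+\varepsilon(n)h_{n+1,i-1} & \text{if } 1\le i\le\lfloor\frac n2\rfloor-1,\\ h_{n+1,\lfloor\frac n2\rfloor}=\varepsilon(n)c_{\lfloor\frac n2\rfloor},\end{cases}$$ where $c_m=\frac{1}{m+1}\binom{2m}{m}$ and $\varepsilon(n)=0$ if $n$ is even, $\varepsilon(n)=1$ if $n$ is odd, with initial values $(h_{3,0},h_{3,1})=(1,0)$. Equivalently, for $0\le i\le\lfloor\frac{n-1}{2}\rfloor$, $$h_{n,i}=\frac{\lfloor\frac n2\rfloor-i}{\lfloor\frac n2\rfloor+i}\binom{\lfloor\frac n2\rfloor+i}{\lfloor\frac n2\rfloor}.$$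
   Context: $[n]=\{1,\dots,n\}$; $\mathfrak S_n$ is the set of permutations of $[n]$ in one-line notation. The circular peak set of $\sigma\in\mathfrak S_n$ is $CP(\sigma)=\{\sigma(i)\mid 2\le i\le n-1,\ \sigma(i-1)<\sigma(i)>\sigma(i+1)\}$; for $S\subseteq[n]$, $CP_n(S)=\{\sigma\in\mathfrak S_n\mid CP(\sigma)=S\}$, and $\mathcal P_n=\{S\subseteq[n]\mid CP_n(S)\neq\emptyset\}$. For $i\ge-1$, $p_{n,i}$ is the number of $S\in\mathcal P_n$ with $|S|=i+1$. The f-polynomial is $\mathcal P_n(x)=\sum_{i=0}^{\lfloor\frac{n-1}{2}\rfloor}p_{n,i-1}x^{\lfloor\frac{n-1}{2}\rfloor-i}$; the h-polynomial is $\mathcal H_n(x)=\mathcal P_n(x-1)$, and the h-vector $(h_{n,0},\dots,h_{n,\lfloor\frac{n-1}{2}\rfloor})$ is defined by $\mathcal H_n(x)=\sum_{i=0}^{\lfloor\frac{n-1}{2}\rfloor}h_{n,i}x^{\lfloor\frac{n-1}{2}\rfloor-i}$. -}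

module Defs where

open import Data.Nat using (ℕ; zero; suc; _+_; _∸_; _<ᵇ_; _≡ᵇ_; ⌊_/2⌋; _/_)
open import Data.Nat.Combinatorics using (_C_)
open import Data.Bool using (Bool; true; false; _∧_; if_then_else_)
open import Data.List using (List; []; _∷_; map; concatMap; _++_; length; upTo)
open import Data.Integer as ℤ using (ℤ; +_)
open import Relation.Binary.PropositionalEquality using (_≡_)

range : ℕ → List ℕ
range n = map suc (upTo n)

insertions : ℕ → List ℕ → List (List ℕ)
insertions x []       = (x ∷ []) ∷ []
insertions x (y ∷ ys) = (x ∷ y ∷ ys) ∷ map (y ∷_) (insertions x ys)

perms : List ℕ → List (List ℕ)
perms []       = [] ∷ []
perms (x ∷ xs) = concatMap (insertions x) (perms xs)

-- 𝔖_n : all permutations of [n] in one-line notation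
Sym : ℕ → List (List ℕ)
Sym n = perms (range n)

peakValues : List ℕ → List ℕ
peakValues (a ∷ b ∷ c ∷ rest) =
  (if (a <ᵇ b) ∧ (c <ᵇ b) then b ∷ [] else []) ++ peakValues (b ∷ c ∷ rest)
peakValues _ = []

filterᵇ : {A : Set} → (A → Bool) → List A → List A
filterᵇ p []       = []
filterᵇ p (x ∷ xs) = if p x then x ∷ filterᵇ p xs else filterᵇ p xs

elemᵇ : ℕ → List ℕ → Bool
elemᵇ x []       = false
elemᵇ x (y ∷ ys) = if x ≡ᵇ y then true else elemᵇ x ys

-- CP(σ) as a subset of [n], represented canonically as an increasing list
CP : ℕ → List ℕ → List ℕ
CP n σ = filterᵇ (λ v → elemᵇ v (peakValues σ)) (range n)

-- Subsets of [n], represented canonically as increasing sublists of range n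

sublists : List ℕ → List (List ℕ)
sublists []       = [] ∷ []
sublists (x ∷ xs) = map (x ∷_) (sublists xs) ++ sublists xs

listEqᵇ : List ℕ → List ℕ → Bool
listEqᵇ []       []       = true
listEqᵇ (x ∷ xs) (y ∷ ys) = (x ≡ᵇ y) ∧ listEqᵇ xs ys
listEqᵇ _        _        = false

anyᵇ : {A : Set} → (A → Bool) → List A → Bool
anyᵇ p []       = false
anyᵇ p (x ∷ xs) = if p x then true else anyᵇ p xs

inPᵇ : ℕ → List ℕ → Bool
inPᵇ n S = anyᵇ (λ σ → listEqᵇ (CP n σ) S) (Sym n)

-- pc n k = #{ S ∈ 𝒫_n : |S| = k } ;  so p_{n,i} = pc n (i+1)
pc : ℕ → ℕ → ℕ
pc n k = length (filterᵇ (λ S → (length S ≡ᵇ k) ∧ inPᵇ n S)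
                        (sublists (range n)))

-- Polynomials with integer coefficients: coefficient lists, ascending degree.

Poly : Set
Poly = List ℤ

addP : Poly → Poly → Poly
addP []       q        = q
addP p        []       = p
addP (a ∷ p)  (b ∷ q)  = (a ℤ.+ b) ∷ addP p q

negP : Poly → Poly
negP = map (λ a → ℤ.- a)

mulXm1 : Poly → Poly
mulXm1 q = addP (+ 0 ∷ q) (negP q)

substXm1 : Poly → Poly
substXm1 []      = []
substXm1 (a ∷ p) = addP (a ∷ []) (mulXm1 (substXm1 p))

coeff : Poly → ℕ → ℤ
coeff []      _       = + 0
coeff (a ∷ p) zero    = a
coeff (a ∷ p) (suc k) = coeff p k

d : ℕ → ℕ
d n = ⌊ n ∸ 1 /2⌋

-- 𝒫_n(x) = Σ_{i=0}^{d} p_{n,i-1} x^{d-i}; coefficient of x^k is p_{n,d-k-1} = pc n (d-k)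
fPoly : ℕ → Poly
fPoly n = map (λ k → + pc n (d n ∸ k)) (upTo (suc (d n)))

hPoly : ℕ → Poly
hPoly n = substXm1 (fPoly n)

h : ℕ → ℕ → ℤ
h n i = coeff (hPoly n) (d n ∸ i)

ε : ℕ → ℤ
ε zero          = + 0
ε (suc zero)    = + 1
ε (suc (suc n)) = ε n

-- c_m = (1/(m+1)) binom(2m, m)   (exact division)
catalan : ℕ → ℕ
catalan m = ((m + m) C m) / suc m

-- A set s₁ < ⋯ < s_k is the circular peak set of a permutation of [n] iff s_j ≥ 2j + 1
-- for all j. Necessity: peaks are never adjacent nor at the ends, and deleting the
-- values above v keeps every peak ≤ v, so fewer than v / 2 peaks are ≤ v. Sufficiency:
-- insert 1, …, n one after another, always at the end of a final increasing run, except
-- that a new peak goes right after the first entry of that run.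
--
-- Splitting off the largest value gives p(n+1, k+1) = p(n, k+1) + p(n, k) whenever
-- 2k + 3 ≤ n + 1, where p(n, k) counts the k-element peak sets. For the f-polynomials
-- this says 𝒫_{n+1}(x) = (1 + x) 𝒫_n(x) for n even and x 𝒫_{n+1}(x) = (1 + x) 𝒫_n(x) - 𝒫_n(0)
-- for n odd; substituting x - 1 for x turns these into ℋ_{n+1} = x ℋ_n, respectively
-- h_{n+1,i} = h_{n,i} + h_{n+1,i-1}. The ballot numbers C(m+i-1, i) - C(m+i-1, i-1)
-- obey the same recurrences, which gives the closed form, and at i = m - 1 they are the
-- Catalan numbers.

module Submission where

open import Defs
open import Data.Bool using (Bool; true; false; _∧_; if_then_else_; T)
open import Data.Bool.Properties using (∧-assoc; ∧-identityʳ; ∧-zeroʳ)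
open import Data.List using (List; []; _∷_; _++_; length; map; upTo; filter)
open import Data.List.Properties using (++-assoc; ++-identityʳ; length-++; map-++; upTo-∷ʳ; length-map; length-upTo; filter-++; filter-all; filter-accept; filter-reject; filter-none)
open import Data.List.Membership.Propositional using (_∈_)
open import Data.List.Membership.Propositional.Properties using (∈-map⁺; ∈-map⁻; ∈-++⁺ˡ; ∈-++⁺ʳ; ∈-++⁻; ∈-∃++; ∈-concat⁺′; ∈-concat⁻′)
open import Data.List.Relation.Unary.All as All using (All; []; _∷_)
open import Data.List.Relation.Unary.All.Properties using (++⁺)
open import Data.List.Relation.Unary.AllPairs using (AllPairs; []; _∷_)
open import Data.List.Relation.Unary.Any using (here; there)
open import Data.List.Relation.Binary.Permutation.Propositional using (_↭_; ↭-refl; ↭-trans; ↭-sym; prep; swap)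
open import Data.List.Relation.Binary.Permutation.Propositional.Properties using (↭-empty-inv; ∈-resp-↭; shift; drop-∷; ++⁺ʳ; ∷↭∷ʳ; ↭-length; filter-↭)
open import Data.List.Relation.Binary.Sublist.Propositional using (_⊆_; []; _∷_; _∷ʳ_)
open import Data.List.Relation.Binary.Sublist.Propositional.Properties using (All-resp-⊆)
open import Data.Product using (_×_; _,_; ∃; proj₁; proj₂)
open import Data.Sum using (_⊎_; inj₁; inj₂)
open import Data.Empty using (⊥-elim)
open import Relation.Binary.PropositionalEquality
open import Relation.Nullary using (yes; no)
open import Function using (_∘_; id)

module Permutations where

  ∈-insertions : ∀ x α β → α ++ x ∷ β ∈ insertions x (α ++ β)
  ∈-insertions x []      []      = here refl
  ∈-insertions x []      (y ∷ β) = here refl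
  ∈-insertions x (a ∷ α) β       = there (∈-map⁺ (a ∷_) (∈-insertions x α β))

  insertions-↭ : ∀ x ys {σ} → σ ∈ insertions x ys → σ ↭ x ∷ ys
  insertions-↭ x []       (here refl) = ↭-refl
  insertions-↭ x (y ∷ ys) (here refl) = ↭-refl
  insertions-↭ x (y ∷ ys) (there σ∈) with ∈-map⁻ (y ∷_) σ∈
  ... | τ , τ∈ , refl = ↭-trans (prep y (insertions-↭ x ys τ∈)) (swap y x ↭-refl)

  ∈-perms⁻ : ∀ xs {σ} → σ ∈ perms xs → σ ↭ xs
  ∈-perms⁻ []       (here refl) = ↭-refl
  ∈-perms⁻ (x ∷ xs) σ∈ with ∈-concat⁻′ (map (insertions x) (perms xs)) σ∈
  ... | ys , σ∈ys , ys∈ with ∈-map⁻ (insertions x) ys∈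
  ...   | τ , τ∈ , refl = ↭-trans (insertions-↭ x τ σ∈ys) (prep x (∈-perms⁻ xs τ∈))

  ∈-perms⁺ : ∀ xs {σ} → σ ↭ xs → σ ∈ perms xs
  ∈-perms⁺ [] σ↭ rewrite ↭-empty-inv σ↭ = here refl
  ∈-perms⁺ (x ∷ xs) σ↭ with ∈-∃++ (∈-resp-↭ (↭-sym σ↭) (here refl))
  ... | α , β , refl = ∈-concat⁺′ (∈-insertions x α β)
         (∈-map⁺ (insertions x) (∈-perms⁺ xs (drop-∷ (↭-trans (↭-sym (shift x α β)) σ↭))))

module PeakValues where
  open import Data.Nat using (ℕ; suc; _+_; _≤_; _<_; z≤n; s≤s; _<ᵇ_)
  open import Data.Nat.Properties

  <ᵇ-true : ∀ {b c} → b < c → (b <ᵇ c) ≡ true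
  <ᵇ-true {b} {c} b<c with b <ᵇ c | <⇒<ᵇ b<c
  ... | true | _ = refl

  <ᵇ-false : ∀ {b c} → b ≤ c → (c <ᵇ b) ≡ false
  <ᵇ-false {b} {c} b≤c with c <ᵇ b in eq
  ... | false = refl
  ... | true  = ⊥-elim (<⇒≱ (<ᵇ⇒< c b (subst T (sym eq) _)) b≤c)

  peakAt : ℕ → ℕ → ℕ → List ℕ
  peakAt a b c = if (a <ᵇ b) ∧ (c <ᵇ b) then b ∷ [] else []

  peakAt-ascending : ∀ a {b c} → b ≤ c → peakAt a b c ≡ []
  peakAt-ascending a {b} {c} b≤c rewrite <ᵇ-false b≤c | ∧-zeroʳ (a <ᵇ b) = refl

  peakAt-descending : ∀ {a b} c → b ≤ a → peakAt a b c ≡ []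
  peakAt-descending c b≤a rewrite <ᵇ-false b≤a = refl

  peakAt-peak : ∀ {a b c} → a < b → c < b → peakAt a b c ≡ b ∷ []
  peakAt-peak a<b c<b rewrite <ᵇ-true a<b | <ᵇ-true c<b = refl

  peakAt-cases : ∀ a b c → peakAt a b c ≡ [] ⊎ (peakAt a b c ≡ b ∷ [] × a < b × c < b)
  peakAt-cases a b c with a <ᵇ b in ab | c <ᵇ b in cb
  ... | true  | true  = inj₂ (refl , <ᵇ⇒< a b (subst T (sym ab) _) , <ᵇ⇒< c b (subst T (sym cb) _))
  ... | true  | false = inj₁ refl
  ... | false | _     = inj₁ refl

  peakValues-split : ∀ α b c γ →
    peakValues (α ++ b ∷ c ∷ γ) ≡ peakValues (α ++ b ∷ c ∷ []) ++ peakValues (b ∷ c ∷ γ)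
  peakValues-split []            b c γ = refl
  peakValues-split (x ∷ [])      b c γ = cong (_++ peakValues (b ∷ c ∷ γ)) (sym (++-identityʳ (peakAt x b c)))
  peakValues-split (x ∷ y ∷ α)   b c γ = split x y α
    where
    split : ∀ x y α → peakValues (x ∷ y ∷ α ++ b ∷ c ∷ γ)
                    ≡ peakValues (x ∷ y ∷ α ++ b ∷ c ∷ []) ++ peakValues (b ∷ c ∷ γ)
    split x y [] = begin
        peakAt x y b ++ (peakAt y b c ++ peakValues (b ∷ c ∷ γ))
      ≡⟨ cong (λ z → peakAt x y b ++ (z ++ _)) (sym (++-identityʳ (peakAt y b c))) ⟩
        peakAt x y b ++ ((peakAt y b c ++ []) ++ peakValues (b ∷ c ∷ γ))
      ≡⟨ sym (++-assoc (peakAt x y b) _ _) ⟩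
        (peakAt x y b ++ (peakAt y b c ++ [])) ++ peakValues (b ∷ c ∷ γ) ∎
      where open ≡-Reasoning
    split x y (z ∷ α) =
      trans (cong (peakAt x y z ++_) (split y z α)) (sym (++-assoc (peakAt x y z) _ _))

  peakValues-ascending-end : ∀ α {b c} → b < c → peakValues (α ++ b ∷ c ∷ []) ≡ peakValues (α ++ b ∷ [])
  peakValues-ascending-end []              b<c = refl
  peakValues-ascending-end (x ∷ [])        b<c = cong (_++ []) (peakAt-ascending x (<⇒≤ b<c))
  peakValues-ascending-end (x ∷ y ∷ [])    b<c = cong (λ z → peakAt x y _ ++ (z ++ [])) (peakAt-ascending y (<⇒≤ b<c))
  peakValues-ascending-end (x ∷ y ∷ z ∷ α) b<c = cong (peakAt x y z ++_) (peakValues-ascending-end (y ∷ z ∷ α) b<c)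

  peakValues-increasing : ∀ {xs} → AllPairs _<_ xs → peakValues xs ≡ []
  peakValues-increasing []                                 = refl
  peakValues-increasing (_ ∷ [])                           = refl
  peakValues-increasing (_ ∷ _ ∷ [])                       = refl
  peakValues-increasing {a ∷ b ∷ c ∷ _} (_ ∷ inc@((b<c ∷ _) ∷ _)) =
    cong₂ _++_ (peakAt-ascending a (<⇒≤ b<c)) (peakValues-increasing inc)

  peakValues-drop-increasing : ∀ {a b γ} → b < a → AllPairs _<_ (b ∷ γ) → peakValues (a ∷ b ∷ γ) ≡ []
  peakValues-drop-increasing {γ = []}    b<a _   = refl
  peakValues-drop-increasing {γ = c ∷ _} b<a inc =
    cong₂ _++_ (peakAt-descending c (<⇒≤ b<a)) (peakValues-increasing inc)

  ∈-peakValues⁻ : ∀ {u} σ → u ∈ peakValues σ →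
    ∃ λ α → ∃ λ a → ∃ λ c → ∃ λ γ → σ ≡ α ++ a ∷ u ∷ c ∷ γ × a < u × c < u
  ∈-peakValues⁻ {u} (a ∷ b ∷ c ∷ r) u∈ =
    locate (∈-++⁻ (peakAt a b c) u∈) (peakAt-cases a b c) (∈-peakValues⁻ (b ∷ c ∷ r))
    where
    Located : List ℕ → Set
    Located σ = ∃ λ α → ∃ λ a → ∃ λ c → ∃ λ γ → σ ≡ α ++ a ∷ u ∷ c ∷ γ × a < u × c < u
    locate : u ∈ peakAt a b c ⊎ u ∈ peakValues (b ∷ c ∷ r) →
             peakAt a b c ≡ [] ⊎ (peakAt a b c ≡ b ∷ [] × a < b × c < b) →
             (u ∈ peakValues (b ∷ c ∷ r) → Located (b ∷ c ∷ r)) → Located (a ∷ b ∷ c ∷ r)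
    locate (inj₂ u∈rest) _ rec with rec u∈rest
    ... | α , a′ , c′ , γ , eq , a′<u , c′<u = a ∷ α , a′ , c′ , γ , cong (a ∷_) eq , a′<u , c′<u
    locate (inj₁ u∈peak) (inj₁ none) _ with subst (u ∈_) none u∈peak
    ... | ()
    locate (inj₁ u∈peak) (inj₂ (peak , a<b , c<b)) _ with subst (u ∈_) peak u∈peak
    ... | here refl = [] , a , c , r , refl , a<b , c<b

  peakValues-length : ∀ a τ → suc (length (peakValues (a ∷ τ)) + length (peakValues (a ∷ τ))) ≤ suc (length τ)
  peakValues-length a []          = s≤s z≤n
  peakValues-length a (b ∷ [])    = s≤s z≤n
  peakValues-length a (b ∷ c ∷ []) with peakAt-cases a b c
  ... | inj₁ none rewrite none       = s≤s z≤n
  ... | inj₂ (peak , _) rewrite peak = ≤-refl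
  peakValues-length a (b ∷ c ∷ d ∷ r)
    with peakAt-cases a b c | peakValues-length b (c ∷ d ∷ r) | peakValues-length c (d ∷ r)
  ... | inj₁ none | from-b | _ rewrite none = m≤n⇒m≤1+n from-b
  ... | inj₂ (peak , _ , c<b) | _ | from-c rewrite peak | peakAt-descending {b} {c} d (<⇒≤ c<b)
    | +-suc (length (peakValues (c ∷ d ∷ r))) (length (peakValues (c ∷ d ∷ r)))
    = s≤s (s≤s from-c)

module CircularPeakSets where
  open import Data.Nat using (ℕ; zero; suc; _+_; _≤_; _≰_; _<_; z≤n; s≤s; _≤ᵇ_; _≡ᵇ_; _≤?_)
  open import Data.Nat.Properties
  open import Data.Nat.Tactic.RingSolver using (solve-∀)
  import Data.List.Relation.Unary.AllPairs.Properties as AllPairs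
  open Permutations
  open PeakValues

  T⇒≡true : ∀ {b} → T b → b ≡ true
  T⇒≡true {true} _ = refl

  ≡true⇒T : ∀ {b} → b ≡ true → T b
  ≡true⇒T refl = _

  ∧-true⁻ : ∀ {a b} → a ∧ b ≡ true → a ≡ true × b ≡ true
  ∧-true⁻ {true} b≡true = refl , b≡true

  ≡ᵇ-refl : ∀ x → (x ≡ᵇ x) ≡ true
  ≡ᵇ-refl zero    = refl
  ≡ᵇ-refl (suc x) = ≡ᵇ-refl x

  ≢⇒≡ᵇ-false : ∀ {x y} → x ≢ y → (x ≡ᵇ y) ≡ false
  ≢⇒≡ᵇ-false {x} {y} x≢y with x ≡ᵇ y in eq
  ... | false = refl
  ... | true  = ⊥-elim (x≢y (≡ᵇ⇒≡ x y (≡true⇒T eq)))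

  range-∷ʳ : ∀ n → range (suc n) ≡ range n ++ suc n ∷ []
  range-∷ʳ n = trans (cong (map suc) (sym (upTo-∷ʳ n))) (map-++ suc (upTo n) (n ∷ []))

  length-range : ∀ n → length (range n) ≡ n
  length-range n = trans (length-map suc (upTo n)) (length-upTo n)

  range-bounded : ∀ n → All (λ v → 1 ≤ v × v ≤ n) (range n)
  range-bounded zero = []
  range-bounded (suc n) rewrite range-∷ʳ n =
    ++⁺ (All.map (λ (1≤v , v≤n) → 1≤v , m≤n⇒m≤1+n v≤n) (range-bounded n)) ((s≤s z≤n , ≤-refl) ∷ [])

  increasing-∷ʳ : ∀ {xs y} → AllPairs _<_ xs → All (_< y) xs → AllPairs _<_ (xs ++ y ∷ [])
  increasing-∷ʳ inc xs<y = AllPairs.++⁺ inc ([] ∷ []) (All.map (_∷ []) xs<y)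

  range-increasing : ∀ n → AllPairs _<_ (range n)
  range-increasing zero = []
  range-increasing (suc n) rewrite range-∷ʳ n =
    increasing-∷ʳ (range-increasing n) (All.map (λ (_ , v≤n) → s≤s v≤n) (range-bounded n))

  increasing-⊆ : ∀ {xs ys} → xs ⊆ ys → AllPairs _<_ ys → AllPairs _<_ xs
  increasing-⊆ []            []          = []
  increasing-⊆ (y ∷ʳ xs⊆ys)  (_ ∷ inc)   = increasing-⊆ xs⊆ys inc
  increasing-⊆ (refl ∷ xs⊆ys) (x< ∷ inc) = All-resp-⊆ xs⊆ys x< ∷ increasing-⊆ xs⊆ys inc

  ∈-sublists⁻ : ∀ xs {S} → S ∈ sublists xs → S ⊆ xs
  ∈-sublists⁻ []       (here refl) = []
  ∈-sublists⁻ (x ∷ xs) S∈ with ∈-++⁻ (map (x ∷_) (sublists xs)) S∈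
  ... | inj₂ S∈rest = x ∷ʳ ∈-sublists⁻ xs S∈rest
  ... | inj₁ S∈with with ∈-map⁻ (x ∷_) S∈with
  ...   | S′ , S′∈ , refl = refl ∷ ∈-sublists⁻ xs S′∈

  ∈-sublists-∷ʳ⁻ : ∀ xs y {S} → S ∈ sublists (xs ++ y ∷ []) →
    S ∈ sublists xs ⊎ ∃ λ S′ → S ≡ S′ ++ y ∷ [] × S′ ∈ sublists xs
  ∈-sublists-∷ʳ⁻ []       y (here refl)         = inj₂ ([] , refl , here refl)
  ∈-sublists-∷ʳ⁻ []       y (there (here refl)) = inj₁ (here refl)
  ∈-sublists-∷ʳ⁻ (x ∷ xs) y S∈ with ∈-++⁻ (map (x ∷_) (sublists (xs ++ y ∷ []))) S∈
  ... | inj₂ S∈rest with ∈-sublists-∷ʳ⁻ xs y S∈rest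
  ...   | inj₁ S∈xs              = inj₁ (∈-++⁺ʳ _ S∈xs)
  ...   | inj₂ (S′ , eq , S′∈xs) = inj₂ (S′ , eq , ∈-++⁺ʳ _ S′∈xs)
  ∈-sublists-∷ʳ⁻ (x ∷ xs) y S∈ | inj₁ S∈with with ∈-map⁻ (x ∷_) S∈with
  ... | T′ , T′∈ , refl with ∈-sublists-∷ʳ⁻ xs y T′∈
  ...   | inj₁ T′∈xs                = inj₁ (∈-++⁺ˡ (∈-map⁺ (x ∷_) T′∈xs))
  ...   | inj₂ (S′ , refl , S′∈xs) = inj₂ (x ∷ S′ , refl , ∈-++⁺ˡ (∈-map⁺ (x ∷_) S′∈xs))

  filterᵇ-cong : ∀ {p q : ℕ → Bool} {xs} → All (λ v → p v ≡ q v) xs → filterᵇ p xs ≡ filterᵇ q xs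
  filterᵇ-cong [] = refl
  filterᵇ-cong {q = q} {x ∷ _} (eq ∷ eqs) rewrite eq with q x
  ... | true  = cong (x ∷_) (filterᵇ-cong eqs)
  ... | false = filterᵇ-cong eqs

  elemᵇ-absent : ∀ {x S} → All (x <_) S → elemᵇ x S ≡ false
  elemᵇ-absent [] = refl
  elemᵇ-absent (x<y ∷ x<S) rewrite ≢⇒≡ᵇ-false (<⇒≢ x<y) = elemᵇ-absent x<S

  filterᵇ-elemᵇ-⊆ : ∀ {S xs} → AllPairs _<_ xs → S ⊆ xs → filterᵇ (λ v → elemᵇ v S) xs ≡ S
  filterᵇ-elemᵇ-⊆ [] [] = refl
  filterᵇ-elemᵇ-⊆ {x ∷ S} (x< ∷ inc) (refl ∷ S⊆xs) rewrite ≡ᵇ-refl x =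
    cong (x ∷_) (trans (filterᵇ-cong (All.map (λ {v} x<v → cong (λ b → if b then true else elemᵇ v S) (≢⇒≡ᵇ-false (>⇒≢ x<v))) x<))
                       (filterᵇ-elemᵇ-⊆ inc S⊆xs))
  filterᵇ-elemᵇ-⊆ (x< ∷ inc) (x ∷ʳ S⊆xs) rewrite elemᵇ-absent (All-resp-⊆ S⊆xs x<) = filterᵇ-elemᵇ-⊆ inc S⊆xs

  admissibleFrom : ℕ → List ℕ → Bool
  admissibleFrom j []      = true
  admissibleFrom j (s ∷ S) = (suc (suc (suc (j + j))) ≤ᵇ s) ∧ admissibleFrom (suc j) S

  admissible : List ℕ → Bool
  admissible = admissibleFrom 0

  admissibleFrom-∷ʳ : ∀ j S y → admissibleFrom j (S ++ y ∷ [])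
    ≡ admissibleFrom j S ∧ (suc (suc (suc ((j + length S) + (j + length S)))) ≤ᵇ y)
  admissibleFrom-∷ʳ j []      y rewrite +-identityʳ j = ∧-identityʳ _
  admissibleFrom-∷ʳ j (s ∷ S) y rewrite admissibleFrom-∷ʳ (suc j) S y | +-suc j (length S) =
    sym (∧-assoc (suc (suc (suc (j + j))) ≤ᵇ s) _ _)

  admissible-∷ʳ : ∀ S y → admissible (S ++ y ∷ [])
    ≡ admissible S ∧ (suc (suc (suc (length S + length S))) ≤ᵇ y)
  admissible-∷ʳ = admissibleFrom-∷ʳ 0

  peakValues-∷ʳ-max : ∀ α β {N} → AllPairs _<_ β → All (_< N) β → α ≡ [] ⊎ 1 ≤ length β →
    peakValues ((α ++ β) ++ N ∷ []) ≡ peakValues (α ++ β)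
  peakValues-∷ʳ-max α [] _ _ (inj₁ refl) = refl
  peakValues-∷ʳ-max α (b ∷ []) {N} _ (b<N ∷ []) _ =
    trans (cong peakValues (++-assoc α (b ∷ []) (N ∷ []))) (peakValues-ascending-end α b<N)
  peakValues-∷ʳ-max α (b₁ ∷ b₂ ∷ β) {N} inc β<N _ = begin
      peakValues ((α ++ b₁ ∷ b₂ ∷ β) ++ N ∷ [])
    ≡⟨ cong peakValues (++-assoc α (b₁ ∷ b₂ ∷ β) (N ∷ [])) ⟩
      peakValues (α ++ b₁ ∷ b₂ ∷ β ++ N ∷ [])
    ≡⟨ peakValues-split α b₁ b₂ (β ++ N ∷ []) ⟩
      peakValues (α ++ b₁ ∷ b₂ ∷ []) ++ peakValues (b₁ ∷ b₂ ∷ β ++ N ∷ [])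
    ≡⟨ cong (_ ++_) (trans (peakValues-increasing (increasing-∷ʳ inc β<N)) (sym (peakValues-increasing inc))) ⟩
      peakValues (α ++ b₁ ∷ b₂ ∷ []) ++ peakValues (b₁ ∷ b₂ ∷ β)
    ≡⟨ sym (peakValues-split α b₁ b₂ β) ⟩
      peakValues (α ++ b₁ ∷ b₂ ∷ β) ∎
    where open ≡-Reasoning

  -- Later, larger values are inserted into the final increasing run, which is
  -- kept long enough to host the peaks still to come.
  record Realisation (n : ℕ) (S : List ℕ) : Set where
    field
      prefix run     : List ℕ
      ↭range         : prefix ++ run ↭ range n
      peaks          : peakValues (prefix ++ run) ≡ S
      run-increasing : AllPairs _<_ run
      run-bounded    : All (_≤ n) run
      run-length     : length run + (length S + length S) ≡ n
      run-nonempty   : prefix ≡ [] ⊎ 1 ≤ length run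

  append-max : ∀ {n S} → Realisation n S → Realisation (suc n) S
  append-max {n} {S} r = record
    { prefix = prefix ; run = run ++ suc n ∷ []
    ; ↭range = subst (prefix ++ run ++ suc n ∷ [] ↭_) (sym (range-∷ʳ n))
                 (subst (_↭ range n ++ suc n ∷ []) (++-assoc prefix run _) (++⁺ʳ _ ↭range))
    ; peaks = trans (cong peakValues (sym (++-assoc prefix run _)))
                (trans (peakValues-∷ʳ-max prefix run run-increasing (All.map s≤s run-bounded) run-nonempty) peaks)
    ; run-increasing = increasing-∷ʳ run-increasing (All.map s≤s run-bounded)
    ; run-bounded = ++⁺ (All.map m≤n⇒m≤1+n run-bounded) (≤-refl ∷ [])
    ; run-length = trans (cong (_+ (length S + length S)) (length-++ run))
                     (trans (lengths (length run) (length S)) (cong suc run-length))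
    ; run-nonempty = inj₂ (subst (1 ≤_) (sym (length-++ run)) (m≤n+m 1 (length run)))
    }
    where
    open Realisation r
    lengths : ∀ l s → (l + 1) + (s + s) ≡ suc (l + (s + s))
    lengths = solve-∀

  room⇒long-run : ∀ {n s l} → suc (suc (suc (s + s))) ≤ suc n → l + (s + s) ≡ n → 2 ≤ l
  room⇒long-run {s = s} {l} room refl = +-cancelʳ-≤ (s + s) 2 l (≤-pred room)

  insert-peak : ∀ {n S} → suc (suc (suc (length S + length S))) ≤ suc n →
    Realisation n S → Realisation (suc n) (S ++ suc n ∷ [])
  insert-peak {n} {S} room r with Realisation.run r | Realisation.run-increasing r | Realisation.run-bounded r
                                | Realisation.run-length r | Realisation.peaks r | Realisation.↭range r
  ... | [] | _ | _ | len | _ | _ with room⇒long-run {s = length S} {l = 0} room len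
  ...   | ()
  insert-peak {S = S} room r | _ ∷ [] | _ | _ | len | _ | _ with room⇒long-run {s = length S} {l = 1} room len
  ...   | s≤s ()
  insert-peak {n} {S} room r | b₁ ∷ b₂ ∷ β | inc@((b₁<b₂ ∷ _) ∷ inc′) | b₁≤n ∷ b₂≤n ∷ β≤n | len | peaks | ↭range = record
    { prefix = α ++ b₁ ∷ N ∷ [] ; run = b₂ ∷ β
    ; ↭range = subst (_↭ range N) (sym (++-assoc α (b₁ ∷ N ∷ []) (b₂ ∷ β))) perm
    ; peaks = trans (cong peakValues (++-assoc α (b₁ ∷ N ∷ []) (b₂ ∷ β))) newPeaks
    ; run-increasing = inc′
    ; run-bounded = All.map m≤n⇒m≤1+n (b₂≤n ∷ β≤n)
    ; run-length = trans (cong (λ z → suc (length β) + (z + z)) (length-++ S))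
                     (trans (lengths (length β) (length S)) (cong suc len))
    ; run-nonempty = inj₂ (s≤s z≤n)
    }
    where
    N : ℕ
    N = suc n
    α : List ℕ
    α = Realisation.prefix r
    lengths : ∀ l s → suc l + ((s + 1) + (s + 1)) ≡ suc (suc (suc l) + (s + s))
    lengths = solve-∀
    oldPeaks : peakValues (α ++ b₁ ∷ []) ≡ S
    oldPeaks = begin
        peakValues (α ++ b₁ ∷ [])                                    ≡⟨ sym (peakValues-ascending-end α b₁<b₂) ⟩
        peakValues (α ++ b₁ ∷ b₂ ∷ [])                               ≡⟨ sym (++-identityʳ _) ⟩
        peakValues (α ++ b₁ ∷ b₂ ∷ []) ++ []                         ≡⟨ cong (_ ++_) (sym (peakValues-increasing inc)) ⟩
        peakValues (α ++ b₁ ∷ b₂ ∷ []) ++ peakValues (b₁ ∷ b₂ ∷ β) ≡⟨ sym (peakValues-split α b₁ b₂ β) ⟩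
        peakValues (α ++ b₁ ∷ b₂ ∷ β)                                ≡⟨ peaks ⟩
        S ∎
      where open ≡-Reasoning
    newPeaks : peakValues (α ++ b₁ ∷ N ∷ b₂ ∷ β) ≡ S ++ N ∷ []
    newPeaks = begin
        peakValues (α ++ b₁ ∷ N ∷ b₂ ∷ β)
      ≡⟨ peakValues-split α b₁ N (b₂ ∷ β) ⟩
        peakValues (α ++ b₁ ∷ N ∷ []) ++ (peakAt b₁ N b₂ ++ peakValues (N ∷ b₂ ∷ β))
      ≡⟨ cong₂ (λ x y → x ++ (y ++ peakValues (N ∷ b₂ ∷ β)))
           (peakValues-ascending-end α (s≤s b₁≤n)) (peakAt-peak (s≤s b₁≤n) (s≤s b₂≤n)) ⟩
        peakValues (α ++ b₁ ∷ []) ++ N ∷ peakValues (N ∷ b₂ ∷ β)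
      ≡⟨ cong₂ (λ x y → x ++ N ∷ y) oldPeaks (peakValues-drop-increasing (s≤s b₂≤n) inc′) ⟩
        S ++ N ∷ [] ∎
      where open ≡-Reasoning
    perm : α ++ b₁ ∷ N ∷ b₂ ∷ β ↭ range N
    perm = ↭-trans (subst (_↭ N ∷ (α ++ b₁ ∷ []) ++ b₂ ∷ β) (++-assoc α (b₁ ∷ []) (N ∷ b₂ ∷ β))
                      (shift N (α ++ b₁ ∷ []) (b₂ ∷ β)))
             (↭-trans (prep N (subst (_↭ range n) (sym (++-assoc α (b₁ ∷ []) (b₂ ∷ β))) ↭range))
             (subst (N ∷ range n ↭_) (sym (range-∷ʳ n)) (∷↭∷ʳ N (range n))))

  realise : ∀ n {S} → S ∈ sublists (range n) → admissible S ≡ true → Realisation n S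
  realise zero (here refl) _ = record
    { prefix = [] ; run = [] ; ↭range = ↭-refl ; peaks = refl ; run-increasing = []
    ; run-bounded = [] ; run-length = refl ; run-nonempty = inj₁ refl }
  realise (suc n) {S} S∈ adm
    with ∈-sublists-∷ʳ⁻ (range n) (suc n) (subst (λ r → S ∈ sublists r) (range-∷ʳ n) S∈)
  ... | inj₁ S∈range = append-max (realise n S∈range adm)
  ... | inj₂ (S′ , refl , S′∈range) with ∧-true⁻ (trans (sym (admissible-∷ʳ S′ (suc n))) adm)
  ...   | adm′ , room = insert-peak (≤ᵇ⇒≤ _ _ (≡true⇒T room)) (realise n S′∈range adm′)

  filterᵇ-⊆ : ∀ (p : ℕ → Bool) xs → filterᵇ p xs ⊆ xs
  filterᵇ-⊆ p [] = []
  filterᵇ-⊆ p (x ∷ xs) with p x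
  ... | true  = refl ∷ filterᵇ-⊆ p xs
  ... | false = x ∷ʳ filterᵇ-⊆ p xs

  filterᵇ-satisfies : ∀ (p : ℕ → Bool) xs → All (λ u → p u ≡ true) (filterᵇ p xs)
  filterᵇ-satisfies p [] = []
  filterᵇ-satisfies p (x ∷ xs) with p x in px
  ... | true  = px ∷ filterᵇ-satisfies p xs
  ... | false = filterᵇ-satisfies p xs

  filter-filterᵇ-comm : ∀ (p : ℕ → Bool) v xs → filter (_≤? v) (filterᵇ p xs) ≡ filterᵇ p (filter (_≤? v) xs)
  filter-filterᵇ-comm p v [] = refl
  filter-filterᵇ-comm p v (x ∷ xs) with p x in px | x ≤? v
  ... | true  | yes x≤v rewrite filter-accept (_≤? v) {xs = filterᵇ p xs} x≤v | filter-accept (_≤? v) {xs = xs} x≤v | px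
    = cong (x ∷_) (filter-filterᵇ-comm p v xs)
  ... | true  | no x≰v rewrite filter-reject (_≤? v) {xs = filterᵇ p xs} x≰v | filter-reject (_≤? v) {xs = xs} x≰v
    = filter-filterᵇ-comm p v xs
  ... | false | yes x≤v rewrite filter-accept (_≤? v) {xs = xs} x≤v | px = filter-filterᵇ-comm p v xs
  ... | false | no x≰v rewrite filter-reject (_≤? v) {xs = xs} x≰v = filter-filterᵇ-comm p v xs

  elemᵇ-sound : ∀ {u} L → elemᵇ u L ≡ true → u ∈ L
  elemᵇ-sound {u} (y ∷ ys) eq with u ≡ᵇ y in u≡ᵇy
  ... | true  = here (≡ᵇ⇒≡ u y (≡true⇒T u≡ᵇy))
  ... | false = there (elemᵇ-sound ys eq)

  filter-≤-range : ∀ {v} n → v ≤ n → filter (_≤? v) (range n) ≡ range v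
  filter-≤-range {v} n v≤n with m≤n⇒m<n∨m≡n v≤n
  ... | inj₂ refl = filter-all (_≤? v) (All.map (λ (_ , u≤v) → u≤v) (range-bounded v))
  filter-≤-range {v} (suc n) _ | inj₁ (s≤s v≤n) = begin
      filter (_≤? v) (range (suc n))
    ≡⟨ cong (filter (_≤? v)) (range-∷ʳ n) ⟩
      filter (_≤? v) (range n ++ suc n ∷ [])
    ≡⟨ filter-++ (_≤? v) (range n) (suc n ∷ []) ⟩
      filter (_≤? v) (range n) ++ filter (_≤? v) (suc n ∷ [])
    ≡⟨ cong₂ _++_ (filter-≤-range n v≤n) (filter-reject (_≤? v) (<⇒≱ (s≤s v≤n))) ⟩
      range v ++ []
    ≡⟨ ++-identityʳ (range v) ⟩
      range v ∎
    where open ≡-Reasoning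

  peakValues-restrict : ∀ {u v} σ → u ∈ peakValues σ → u ≤ v → u ∈ peakValues (filter (_≤? v) σ)
  peakValues-restrict {u} {v} σ u∈ u≤v with ∈-peakValues⁻ σ u∈
  ... | α , a , c , γ , refl , a<u , c<u = subst (λ τ → u ∈ peakValues τ) (sym restricted) stillPeak
    where
    a≤v : a ≤ v
    a≤v = ≤-trans (<⇒≤ a<u) u≤v
    c≤v : c ≤ v
    c≤v = ≤-trans (<⇒≤ c<u) u≤v
    restricted : filter (_≤? v) (α ++ a ∷ u ∷ c ∷ γ) ≡ filter (_≤? v) α ++ a ∷ u ∷ c ∷ filter (_≤? v) γ
    restricted = trans (filter-++ (_≤? v) α (a ∷ u ∷ c ∷ γ)) (cong (filter (_≤? v) α ++_)
      (trans (filter-accept (_≤? v) a≤v) (cong (a ∷_)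
      (trans (filter-accept (_≤? v) u≤v) (cong (u ∷_) (filter-accept (_≤? v) c≤v))))))
    stillPeak : u ∈ peakValues (filter (_≤? v) α ++ a ∷ u ∷ c ∷ filter (_≤? v) γ)
    stillPeak rewrite peakValues-split (filter (_≤? v) α) a u (c ∷ filter (_≤? v) γ) | peakAt-peak a<u c<u =
      ∈-++⁺ʳ _ (here refl)

  increasing-⊆-length : ∀ {R L} → AllPairs _<_ R → All (_∈ L) R → length R ≤ length L
  increasing-⊆-length [] _ = z≤n
  increasing-⊆-length {r ∷ R} (r< ∷ inc) (r∈L ∷ R⊆L) with ∈-∃++ r∈L
  ... | α , β , refl = subst (suc (length R) ≤_) (sym removed) (s≤s (increasing-⊆-length inc (remove r< R⊆L)))
    where
    ∈-remove : ∀ α {y} → y ∈ α ++ r ∷ β → y ≢ r → y ∈ α ++ β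
    ∈-remove []      (here y≡r)  y≢r = ⊥-elim (y≢r y≡r)
    ∈-remove []      (there y∈)  _   = y∈
    ∈-remove (x ∷ α) (here y≡x)  _   = here y≡x
    ∈-remove (x ∷ α) (there y∈)  y≢r = there (∈-remove α y∈ y≢r)
    remove : ∀ {R′} → All (r <_) R′ → All (_∈ α ++ r ∷ β) R′ → All (_∈ α ++ β) R′
    remove [] [] = []
    remove (r<y ∷ r<R′) (y∈ ∷ R′∈) = ∈-remove α y∈ (>⇒≢ r<y) ∷ remove r<R′ R′∈
    removed : length (α ++ r ∷ β) ≡ suc (length (α ++ β))
    removed rewrite length-++ α {r ∷ β} | length-++ α {β} = +-suc (length α) (length β)

  count≤ : ℕ → List ℕ → ℕ
  count≤ v S = length (filter (_≤? v) S)

  admissibleFrom-counts : ∀ j {S} → AllPairs _<_ S →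
    (∀ {v} → v ∈ S → suc ((j + count≤ v S) + (j + count≤ v S)) ≤ v) → admissibleFrom j S ≡ true
  admissibleFrom-counts j [] _ = refl
  admissibleFrom-counts j {s ∷ S} (s< ∷ inc) bound =
    cong₂ _∧_ (T⇒≡true (≤⇒≤ᵇ first)) (admissibleFrom-counts (suc j) inc bound′)
    where
    count-self : count≤ s (s ∷ S) ≡ 1
    count-self = cong length (trans (filter-accept (_≤? s) (≤-refl {s})) (cong (s ∷_) (filter-none (_≤? s) (All.map <⇒≱ s<))))
    twice : ∀ j → suc ((j + 1) + (j + 1)) ≡ suc (suc (suc (j + j)))
    twice = solve-∀
    first : suc (suc (suc (j + j))) ≤ s
    first = subst (_≤ s) (trans (cong (λ c → suc ((j + c) + (j + c))) count-self) (twice j)) (bound (here refl))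
    bound′ : ∀ {v} → v ∈ S → suc ((suc j + count≤ v S) + (suc j + count≤ v S)) ≤ v
    bound′ {v} v∈ = subst (_≤ v) (cong (λ c → suc (c + c)) (trans (cong (j +_) count-cons) (+-suc j _))) (bound (there v∈))
      where
      count-cons : count≤ v (s ∷ S) ≡ suc (count≤ v S)
      count-cons = cong length (filter-accept (_≤? v) (<⇒≤ (All.lookup s< v∈)))

  CP-admissible : ∀ n σ → σ ↭ range n → admissible (CP n σ) ≡ true
  CP-admissible n σ σ↭ = admissibleFrom-counts 0 (increasing-⊆ (filterᵇ-⊆ isPeak (range n)) (range-increasing n)) bound
    where
    isPeak : ℕ → Bool
    isPeak v = elemᵇ v (peakValues σ)
    bound : ∀ {v} → v ∈ CP n σ → suc (count≤ v (CP n σ) + count≤ v (CP n σ)) ≤ v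
    bound {v} v∈ = ≤-trans (s≤s (+-mono-≤ count≤peaks count≤peaks)) (peaks-bound τ length-τ)
      where
      bounds : 1 ≤ v × v ≤ n
      bounds = All.lookup (All-resp-⊆ (filterᵇ-⊆ isPeak (range n)) (range-bounded n)) v∈
      v≤n : v ≤ n
      v≤n = proj₂ bounds
      τ : List ℕ
      τ = filter (_≤? v) σ
      length-τ : length τ ≡ v
      length-τ = trans (↭-length (filter-↭ (_≤? v) σ↭)) (trans (cong length (filter-≤-range n v≤n)) (length-range v))
      peaks-bound : ∀ τ → length τ ≡ v → suc (length (peakValues τ) + length (peakValues τ)) ≤ v
      peaks-bound []      refl = ⊥-elim (1+n≰n (proj₁ bounds))
      peaks-bound (t ∷ τ) refl = peakValues-length t τ
      R : List ℕ
      R = filterᵇ isPeak (range v)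
      count≡ : count≤ v (CP n σ) ≡ length R
      count≡ = cong length (trans (filter-filterᵇ-comm isPeak v (range n)) (cong (filterᵇ isPeak) (filter-≤-range n v≤n)))
      R⊆peaks : All (_∈ peakValues τ) R
      R⊆peaks = All.zipWith (λ ((_ , u≤v) , peak) → peakValues-restrict σ (elemᵇ-sound (peakValues σ) peak) u≤v)
                  (All-resp-⊆ (filterᵇ-⊆ isPeak (range v)) (range-bounded v) , filterᵇ-satisfies isPeak (range v))
      count≤peaks : count≤ v (CP n σ) ≤ length (peakValues τ)
      count≤peaks = subst (_≤ _) (sym count≡)
        (increasing-⊆-length (increasing-⊆ (filterᵇ-⊆ isPeak (range v)) (range-increasing v)) R⊆peaks)

  anyᵇ-complete : ∀ {A : Set} (p : A → Bool) {x xs} → x ∈ xs → p x ≡ true → anyᵇ p xs ≡ true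
  anyᵇ-complete p (here refl) px rewrite px = refl
  anyᵇ-complete p {xs = y ∷ ys} (there x∈) px with p y
  ... | true  = refl
  ... | false = anyᵇ-complete p x∈ px

  anyᵇ-sound : ∀ {A : Set} (p : A → Bool) xs → anyᵇ p xs ≡ true → ∃ λ x → x ∈ xs × p x ≡ true
  anyᵇ-sound p (x ∷ xs) any with p x in px
  ... | true  = x , here refl , px
  ... | false with anyᵇ-sound p xs any
  ...   | y , y∈ , py = y , there y∈ , py

  listEqᵇ-refl : ∀ S → listEqᵇ S S ≡ true
  listEqᵇ-refl []      = refl
  listEqᵇ-refl (x ∷ S) rewrite ≡ᵇ-refl x = listEqᵇ-refl S

  listEqᵇ-sound : ∀ S S′ → listEqᵇ S S′ ≡ true → S ≡ S′
  listEqᵇ-sound []      []        _  = refl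
  listEqᵇ-sound (x ∷ S) (y ∷ S′) eq with ∧-true⁻ eq
  ... | x≡ᵇy , rest = cong₂ _∷_ (≡ᵇ⇒≡ x y (≡true⇒T x≡ᵇy)) (listEqᵇ-sound S S′ rest)

  inPᵇ≡admissible : ∀ n {S} → S ∈ sublists (range n) → inPᵇ n S ≡ admissible S
  inPᵇ≡admissible n {S} S∈ with admissible S in adm
  ... | true = anyᵇ-complete (λ σ → listEqᵇ (CP n σ) S) (∈-perms⁺ (range n) ↭range)
                 (trans (cong (λ S′ → listEqᵇ S′ S) CP≡S) (listEqᵇ-refl S))
    where
    open Realisation (realise n S∈ adm)
    CP≡S : CP n (prefix ++ run) ≡ S
    CP≡S = trans (cong (λ P → filterᵇ (λ v → elemᵇ v P) (range n)) peaks)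
                 (filterᵇ-elemᵇ-⊆ (range-increasing n) (∈-sublists⁻ (range n) S∈))
  ... | false with inPᵇ n S in inP
  ...   | false = refl
  ...   | true with anyᵇ-sound (λ σ → listEqᵇ (CP n σ) S) (Sym n) inP
  ...     | σ , σ∈ , CP≡S with trans (sym adm) (trans (cong admissible (sym (listEqᵇ-sound (CP n σ) S CP≡S)))
                                                   (CP-admissible n σ (∈-perms⁻ (range n) σ∈)))
  ...       | ()

  countᵇ : {A : Set} → (A → Bool) → List A → ℕ
  countᵇ p xs = length (filterᵇ p xs)

  countᵇ-++ : ∀ {A : Set} (p : A → Bool) xs ys → countᵇ p (xs ++ ys) ≡ countᵇ p xs + countᵇ p ys
  countᵇ-++ p []       ys = refl
  countᵇ-++ p (x ∷ xs) ys with p x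
  ... | true  = cong suc (countᵇ-++ p xs ys)
  ... | false = countᵇ-++ p xs ys

  countᵇ-map : ∀ {A : Set} (p : A → Bool) (f : A → A) xs → countᵇ p (map f xs) ≡ countᵇ (λ x → p (f x)) xs
  countᵇ-map p f []       = refl
  countᵇ-map p f (x ∷ xs) with p (f x)
  ... | true  = cong suc (countᵇ-map p f xs)
  ... | false = countᵇ-map p f xs

  countᵇ-cong : ∀ {A : Set} {p q : A → Bool} xs → (∀ {x} → x ∈ xs → p x ≡ q x) → countᵇ p xs ≡ countᵇ q xs
  countᵇ-cong []                  _ = refl
  countᵇ-cong {q = q} (x ∷ xs) p≡q rewrite p≡q (here refl) with q x
  ... | true  = cong suc (countᵇ-cong xs (p≡q ∘ there))
  ... | false = countᵇ-cong xs (p≡q ∘ there)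

  countᵇ-none : ∀ {A : Set} (p : A → Bool) xs → (∀ x → p x ≡ false) → countᵇ p xs ≡ 0
  countᵇ-none p []       _    = refl
  countᵇ-none p (x ∷ xs) none rewrite none x = countᵇ-none p xs none

  countᵇ-sublists-∷ʳ : ∀ (p : List ℕ → Bool) xs y → countᵇ p (sublists (xs ++ y ∷ []))
    ≡ countᵇ p (sublists xs) + countᵇ (λ S → p (S ++ y ∷ [])) (sublists xs)
  countᵇ-sublists-∷ʳ p [] y with p (y ∷ []) | p []
  ... | true  | true  = refl
  ... | true  | false = refl
  ... | false | true  = refl
  ... | false | false = refl
  countᵇ-sublists-∷ʳ p (x ∷ xs) y = begin
      countᵇ p (map (x ∷_) subs′ ++ subs′)
    ≡⟨ trans (countᵇ-++ p (map (x ∷_) subs′) subs′) (cong (_+ countᵇ p subs′) (countᵇ-map p (x ∷_) subs′)) ⟩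
      countᵇ (λ S → p (x ∷ S)) subs′ + countᵇ p subs′
    ≡⟨ cong₂ _+_ (countᵇ-sublists-∷ʳ (λ S → p (x ∷ S)) xs y) (countᵇ-sublists-∷ʳ p xs y) ⟩
      (countᵇ (λ S → p (x ∷ S)) subs + countᵇ (λ S → p (x ∷ S ++ y ∷ [])) subs)
        + (countᵇ p subs + countᵇ (λ S → p (S ++ y ∷ [])) subs)
    ≡⟨ interchange (countᵇ (λ S → p (x ∷ S)) subs) _ _ _ ⟩
      (countᵇ (λ S → p (x ∷ S)) subs + countᵇ p subs)
        + (countᵇ (λ S → p (x ∷ S ++ y ∷ [])) subs + countᵇ (λ S → p (S ++ y ∷ [])) subs)
    ≡⟨ sym (cong₂ _+_ (trans (countᵇ-++ p (map (x ∷_) subs) subs) (cong (_+ _) (countᵇ-map p (x ∷_) subs)))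
                      (trans (countᵇ-++ _ (map (x ∷_) subs) subs) (cong (_+ _) (countᵇ-map (λ S → p (S ++ y ∷ [])) (x ∷_) subs)))) ⟩
      countᵇ p (map (x ∷_) subs ++ subs) + countᵇ (λ S → p (S ++ y ∷ [])) (map (x ∷_) subs ++ subs) ∎
    where
    open ≡-Reasoning
    subs : List (List ℕ)
    subs = sublists xs
    subs′ : List (List ℕ)
    subs′ = sublists (xs ++ y ∷ [])
    interchange : ∀ a b c d → (a + b) + (c + d) ≡ (a + c) + (b + d)
    interchange = solve-∀

  admissibleOfSize : ℕ → List ℕ → Bool
  admissibleOfSize k S = (length S ≡ᵇ k) ∧ admissible S

  pc≡countᵇ : ∀ n k → pc n k ≡ countᵇ (admissibleOfSize k) (sublists (range n))
  pc≡countᵇ n k = countᵇ-cong (sublists (range n)) (λ {S} S∈ → cong ((length S ≡ᵇ k) ∧_) (inPᵇ≡admissible n S∈))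

  pc-suc : ∀ n k → pc (suc n) k
    ≡ pc n k + countᵇ (λ S → admissibleOfSize k (S ++ suc n ∷ [])) (sublists (range n))
  pc-suc n k = begin
      pc (suc n) k
    ≡⟨ pc≡countᵇ (suc n) k ⟩
      countᵇ (admissibleOfSize k) (sublists (range (suc n)))
    ≡⟨ cong (λ r → countᵇ (admissibleOfSize k) (sublists r)) (range-∷ʳ n) ⟩
      countᵇ (admissibleOfSize k) (sublists (range n ++ suc n ∷ []))
    ≡⟨ countᵇ-sublists-∷ʳ (admissibleOfSize k) (range n) (suc n) ⟩
      countᵇ (admissibleOfSize k) (sublists (range n)) + withMax
    ≡⟨ cong (_+ withMax) (sym (pc≡countᵇ n k)) ⟩
      pc n k + withMax ∎
    where
    open ≡-Reasoning
    withMax : ℕ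
    withMax = countᵇ (λ S → admissibleOfSize k (S ++ suc n ∷ [])) (sublists (range n))

  admissibleOfSize-∷ʳ : ∀ k S N → admissibleOfSize (suc k) (S ++ N ∷ [])
    ≡ (length S ≡ᵇ k) ∧ (admissible S ∧ (suc (suc (suc (length S + length S))) ≤ᵇ N))
  admissibleOfSize-∷ʳ k S N rewrite length-++ S {N ∷ []} | +-comm (length S) 1 | admissible-∷ʳ S N = refl

  pc-suc-zero : ∀ n → pc (suc n) 0 ≡ pc n 0
  pc-suc-zero n = trans (pc-suc n 0) (trans (cong (pc n 0 +_) (countᵇ-none _ (sublists (range n)) tooLong)) (+-identityʳ _))
    where
    tooLong : ∀ S → admissibleOfSize 0 (S ++ suc n ∷ []) ≡ false
    tooLong S rewrite length-++ S {suc n ∷ []} | +-comm (length S) 1 = refl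

  pc-pascal : ∀ n k → suc (suc (suc (k + k))) ≤ suc n → pc (suc n) (suc k) ≡ pc n (suc k) + pc n k
  pc-pascal n k room = trans (pc-suc n (suc k)) (cong (pc n (suc k) +_)
    (trans (countᵇ-cong (sublists (range n)) (λ {S} _ → dropLast S)) (sym (pc≡countᵇ n k))))
    where
    dropLast : ∀ S → admissibleOfSize (suc k) (S ++ suc n ∷ []) ≡ admissibleOfSize k S
    dropLast S rewrite admissibleOfSize-∷ʳ k S (suc n) with length S ≡ᵇ k in len
    ... | false = refl
    ... | true rewrite ≡ᵇ⇒≡ (length S) k (≡true⇒T len) | T⇒≡true (≤⇒≤ᵇ room) = ∧-identityʳ (admissible S)

  pc-no-room : ∀ n k → suc (suc (suc (k + k))) ≰ suc n → pc (suc n) (suc k) ≡ pc n (suc k)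
  pc-no-room n k noRoom = trans (pc-suc n (suc k))
    (trans (cong (pc n (suc k) +_) (countᵇ-none _ (sublists (range n)) noPeak)) (+-identityʳ _))
    where
    noPeak : ∀ S → admissibleOfSize (suc k) (S ++ suc n ∷ []) ≡ false
    noPeak S rewrite admissibleOfSize-∷ʳ k S (suc n) with length S ≡ᵇ k in len
    ... | false = refl
    ... | true rewrite ≡ᵇ⇒≡ (length S) k (≡true⇒T len) with suc (suc (suc (k + k))) ≤ᵇ suc n in fits
    ...   | true  = ⊥-elim (noRoom (≤ᵇ⇒≤ _ _ (≡true⇒T fits)))
    ...   | false = ∧-zeroʳ (admissible S)

  pc-small : ∀ n k → n < suc (suc (suc (k + k))) → pc n (suc k) ≡ 0
  pc-small zero    k _   = refl
  pc-small (suc n) k n< = trans (pc-no-room n k (<⇒≱ n<)) (pc-small n k (<-trans (n<1+n n) n<))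

module Substitution where
  open import Data.Nat using (zero; suc; _≤_; s≤s)
  open import Data.Nat.Properties using (m≤n⇒m≤1+n)
  open import Data.Integer using (+_; -_; _+_; _-_)
  import Data.Integer.Properties as ℤₚ
  open import Data.Integer.Tactic.RingSolver using (solve-∀)
  open import Data.List using (drop)

  infix 4 _≈_
  _≈_ : Poly → Poly → Set
  p ≈ q = ∀ k → coeff p k ≡ coeff q k

  coeff-addP : ∀ p q k → coeff (addP p q) k ≡ coeff p k + coeff q k
  coeff-addP []      q       k       = sym (ℤₚ.+-identityˡ (coeff q k))
  coeff-addP (a ∷ p) []      k       = sym (ℤₚ.+-identityʳ (coeff (a ∷ p) k))
  coeff-addP (a ∷ p) (b ∷ q) zero    = refl
  coeff-addP (a ∷ p) (b ∷ q) (suc k) = coeff-addP p q k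

  coeff-negP : ∀ q k → coeff (negP q) k ≡ - coeff q k
  coeff-negP []      k       = refl
  coeff-negP (a ∷ q) zero    = refl
  coeff-negP (a ∷ q) (suc k) = coeff-negP q k

  coeff-substXm1-∷-zero : ∀ a p → coeff (substXm1 (a ∷ p)) 0 ≡ a - coeff (substXm1 p) 0
  coeff-substXm1-∷-zero a p
    rewrite coeff-addP (a ∷ []) (mulXm1 (substXm1 p)) 0
          | coeff-addP (+ 0 ∷ substXm1 p) (negP (substXm1 p)) 0
          | coeff-negP (substXm1 p) 0 = cong (λ x → a + x) (ℤₚ.+-identityˡ _)

  coeff-substXm1-∷-suc : ∀ a p k →
    coeff (substXm1 (a ∷ p)) (suc k) ≡ coeff (substXm1 p) k - coeff (substXm1 p) (suc k)
  coeff-substXm1-∷-suc a p k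
    rewrite coeff-addP (a ∷ []) (mulXm1 (substXm1 p)) (suc k)
          | coeff-addP (+ 0 ∷ substXm1 p) (negP (substXm1 p)) (suc k)
          | coeff-negP (substXm1 p) (suc k) = ℤₚ.+-identityˡ _

  substXm1-∷-cong : ∀ {a b} p q → a ≡ b → substXm1 p ≈ substXm1 q → substXm1 (a ∷ p) ≈ substXm1 (b ∷ q)
  substXm1-∷-cong {a} p q refl Sp≈Sq zero =
    trans (coeff-substXm1-∷-zero a p) (trans (cong (λ x → a - x) (Sp≈Sq 0)) (sym (coeff-substXm1-∷-zero a q)))
  substXm1-∷-cong {a} p q refl Sp≈Sq (suc k) =
    trans (coeff-substXm1-∷-suc a p k) (trans (cong₂ _-_ (Sp≈Sq k) (Sp≈Sq (suc k))) (sym (coeff-substXm1-∷-suc a q k)))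

  substXm1-[]≈[0] : substXm1 [] ≈ substXm1 (+ 0 ∷ [])
  substXm1-[]≈[0] zero    = refl
  substXm1-[]≈[0] (suc k) = refl

  substXm1-cong : ∀ p q → p ≈ q → substXm1 p ≈ substXm1 q
  substXm1-cong []      []      _   k = refl
  substXm1-cong (a ∷ p) (b ∷ q) p≈q   = substXm1-∷-cong p q (p≈q 0) (substXm1-cong p q (p≈q ∘ suc))
  substXm1-cong []      (b ∷ q) p≈q k =
    trans (substXm1-[]≈[0] k) (substXm1-∷-cong [] q (p≈q 0) (substXm1-cong [] q (p≈q ∘ suc)) k)
  substXm1-cong (a ∷ p) []      p≈q k =
    trans (substXm1-∷-cong p [] (p≈q 0) (substXm1-cong p [] (p≈q ∘ suc)) k) (sym (substXm1-[]≈[0] k))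

  substXm1-addP : ∀ p q → substXm1 (addP p q) ≈ addP (substXm1 p) (substXm1 q)
  substXm1-addP []      q       k = refl
  substXm1-addP (a ∷ p) []      k = sym (trans (coeff-addP (substXm1 (a ∷ p)) [] k) (ℤₚ.+-identityʳ _))
  substXm1-addP (a ∷ p) (b ∷ q) zero = begin
      coeff (substXm1 ((a + b) ∷ addP p q)) 0
    ≡⟨ coeff-substXm1-∷-zero (a + b) (addP p q) ⟩
      (a + b) - coeff (substXm1 (addP p q)) 0
    ≡⟨ cong (λ x → (a + b) - x) (trans (substXm1-addP p q 0) (coeff-addP (substXm1 p) (substXm1 q) 0)) ⟩
      (a + b) - (coeff (substXm1 p) 0 + coeff (substXm1 q) 0)
    ≡⟨ regroup a b (coeff (substXm1 p) 0) (coeff (substXm1 q) 0) ⟩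
      (a - coeff (substXm1 p) 0) + (b - coeff (substXm1 q) 0)
    ≡⟨ sym (trans (coeff-addP (substXm1 (a ∷ p)) (substXm1 (b ∷ q)) 0)
                  (cong₂ _+_ (coeff-substXm1-∷-zero a p) (coeff-substXm1-∷-zero b q))) ⟩
      coeff (addP (substXm1 (a ∷ p)) (substXm1 (b ∷ q))) 0 ∎
    where
    open ≡-Reasoning
    regroup : ∀ a b x y → (a + b) - (x + y) ≡ (a - x) + (b - y)
    regroup = solve-∀
  substXm1-addP (a ∷ p) (b ∷ q) (suc k) = begin
      coeff (substXm1 ((a + b) ∷ addP p q)) (suc k)
    ≡⟨ coeff-substXm1-∷-suc (a + b) (addP p q) k ⟩
      coeff (substXm1 (addP p q)) k - coeff (substXm1 (addP p q)) (suc k)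
    ≡⟨ cong₂ _-_ (trans (substXm1-addP p q k) (coeff-addP (substXm1 p) (substXm1 q) k))
                 (trans (substXm1-addP p q (suc k)) (coeff-addP (substXm1 p) (substXm1 q) (suc k))) ⟩
      (coeff (substXm1 p) k + coeff (substXm1 q) k) - (coeff (substXm1 p) (suc k) + coeff (substXm1 q) (suc k))
    ≡⟨ regroup (coeff (substXm1 p) k) (coeff (substXm1 q) k) (coeff (substXm1 p) (suc k)) (coeff (substXm1 q) (suc k)) ⟩
      (coeff (substXm1 p) k - coeff (substXm1 p) (suc k)) + (coeff (substXm1 q) k - coeff (substXm1 q) (suc k))
    ≡⟨ sym (trans (coeff-addP (substXm1 (a ∷ p)) (substXm1 (b ∷ q)) (suc k))
                  (cong₂ _+_ (coeff-substXm1-∷-suc a p k) (coeff-substXm1-∷-suc b q k))) ⟩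
      coeff (addP (substXm1 (a ∷ p)) (substXm1 (b ∷ q))) (suc k) ∎
    where
    open ≡-Reasoning
    regroup : ∀ x y x′ y′ → (x + y) - (x′ + y′) ≡ (x - x′) + (y - y′)
    regroup = solve-∀

  coeff-substXm1-≥ : ∀ p {k} → length p ≤ k → coeff (substXm1 p) k ≡ + 0
  coeff-substXm1-≥ []      _ = refl
  coeff-substXm1-≥ (a ∷ p) {suc k} (s≤s len≤k) =
    trans (coeff-substXm1-∷-suc a p k)
          (cong₂ _-_ (coeff-substXm1-≥ p len≤k) (coeff-substXm1-≥ p (m≤n⇒m≤1+n len≤k)))

  -- F′ = (1 + x) F, so F′(x - 1) = x · F(x - 1).
  substXm1-times-1+x : ∀ F F′ → coeff F′ 0 ≡ coeff F 0 → (∀ k → coeff F′ (suc k) ≡ coeff F k + coeff F (suc k)) →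
    coeff (substXm1 F′) 0 ≡ + 0 × (∀ k → coeff (substXm1 F′) (suc k) ≡ coeff (substXm1 F) k)
  substXm1-times-1+x F F′ F′₀ F′ₛ = at-zero , at-suc
    where
    F′≈ : F′ ≈ addP F (+ 0 ∷ F)
    F′≈ zero    = trans F′₀ (trans (sym (ℤₚ.+-identityʳ _)) (sym (coeff-addP F (+ 0 ∷ F) 0)))
    F′≈ (suc k) = trans (F′ₛ k) (trans (ℤₚ.+-comm (coeff F k) (coeff F (suc k))) (sym (coeff-addP F (+ 0 ∷ F) (suc k))))
    H : Poly
    H = substXm1 F
    H′≈ : substXm1 F′ ≈ addP H (substXm1 (+ 0 ∷ F))
    H′≈ k = trans (substXm1-cong F′ (addP F (+ 0 ∷ F)) F′≈ k) (substXm1-addP F (+ 0 ∷ F) k)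
    at-zero : coeff (substXm1 F′) 0 ≡ + 0
    at-zero = begin
        coeff (substXm1 F′) 0
      ≡⟨ trans (H′≈ 0) (coeff-addP H (substXm1 (+ 0 ∷ F)) 0) ⟩
        coeff H 0 + coeff (substXm1 (+ 0 ∷ F)) 0
      ≡⟨ cong (λ x → coeff H 0 + x) (coeff-substXm1-∷-zero (+ 0) F) ⟩
        coeff H 0 + (+ 0 - coeff H 0)
      ≡⟨ cancel (coeff H 0) ⟩
        + 0 ∎
      where
      open ≡-Reasoning
      cancel : ∀ x → x + (+ 0 - x) ≡ + 0
      cancel = solve-∀
    at-suc : ∀ k → coeff (substXm1 F′) (suc k) ≡ coeff H k
    at-suc k = begin
        coeff (substXm1 F′) (suc k)
      ≡⟨ trans (H′≈ (suc k)) (coeff-addP H (substXm1 (+ 0 ∷ F)) (suc k)) ⟩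
        coeff H (suc k) + coeff (substXm1 (+ 0 ∷ F)) (suc k)
      ≡⟨ cong (λ x → coeff H (suc k) + x) (coeff-substXm1-∷-suc (+ 0) F k) ⟩
        coeff H (suc k) + (coeff H k - coeff H (suc k))
      ≡⟨ cancel (coeff H (suc k)) (coeff H k) ⟩
        coeff H k ∎
      where
      open ≡-Reasoning
      cancel : ∀ x y → x + (y - x) ≡ y
      cancel = solve-∀

  -- Write F = F(0) + x F₊. Then F′ = F + F₊, and after substituting x - 1 for x the images
  -- satisfy H′ = H + U and H = F(0) + (x - 1) U, so H′ = F(0) + x U.
  substXm1-pascal : ∀ F F′ → (∀ k → coeff F′ k ≡ coeff F k + coeff F (suc k)) →
    ∀ k → coeff (substXm1 F′) k ≡ coeff (substXm1 F) k + coeff (substXm1 F′) (suc k)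
  substXm1-pascal F F′ F′≡ k = begin
      coeff (substXm1 F′) k
    ≡⟨ H′≡ k ⟩
      coeff H k + coeff U k
    ≡⟨ cong (λ x → coeff H k + x) (sym (H′≡U k)) ⟩
      coeff H k + coeff (substXm1 F′) (suc k) ∎
    where
    open ≡-Reasoning
    F₊ : Poly
    F₊ = drop 1 F
    coeff-F₊ : ∀ k → coeff F₊ k ≡ coeff F (suc k)
    coeff-F₊ k = coeff-drop-1 F
      where
      coeff-drop-1 : ∀ F → coeff (drop 1 F) k ≡ coeff F (suc k)
      coeff-drop-1 []      = refl
      coeff-drop-1 (_ ∷ _) = refl
    H : Poly
    H = substXm1 F
    U : Poly
    U = substXm1 F₊
    F≈ : F ≈ coeff F 0 ∷ F₊
    F≈ zero    = refl
    F≈ (suc k) = sym (coeff-F₊ k)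
    H′≡ : ∀ k → coeff (substXm1 F′) k ≡ coeff H k + coeff U k
    H′≡ k = trans (substXm1-cong F′ (addP F F₊)
                    (λ j → trans (F′≡ j) (trans (cong (λ x → coeff F j + x) (sym (coeff-F₊ j))) (sym (coeff-addP F F₊ j)))) k)
                  (trans (substXm1-addP F F₊ k) (coeff-addP H U k))
    H′≡U : ∀ k → coeff (substXm1 F′) (suc k) ≡ coeff U k
    H′≡U k = begin
        coeff (substXm1 F′) (suc k)
      ≡⟨ H′≡ (suc k) ⟩
        coeff H (suc k) + coeff U (suc k)
      ≡⟨ cong (_+ coeff U (suc k)) (trans (substXm1-cong F (coeff F 0 ∷ F₊) F≈ (suc k)) (coeff-substXm1-∷-suc (coeff F 0) F₊ k)) ⟩
        (coeff U k - coeff U (suc k)) + coeff U (suc k)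
      ≡⟨ cancel (coeff U k) (coeff U (suc k)) ⟩
        coeff U k ∎
      where
      cancel : ∀ x y → (x - y) + y ≡ x
      cancel = solve-∀


module BallotNumbers where
  open import Data.Nat as ℕ using (ℕ; zero; suc)
  import Data.Nat.Properties as ℕₚ
  open import Data.Nat.Combinatorics using (_C_; nCk+nC[k+1]≡[n+1]C[k+1]; nCk≡nC[n∸k]; nCn≡1; nC1≡n)
  open import Data.Nat.DivMod using (m*n/n≡m)
  open import Data.Integer using (ℤ; +_; _+_; _-_; _*_; -[1+_])
  import Data.Integer.Properties as ℤₚ
  open import Data.Integer.Tactic.RingSolver using (solve-∀)

  C-symmetric : ∀ a b → (a ℕ.+ b) C a ≡ (a ℕ.+ b) C b
  C-symmetric a b = trans (nCk≡nC[n∸k] (ℕₚ.m≤m+n a b)) (cong ((a ℕ.+ b) C_) (ℕₚ.m+n∸m≡n a b))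

  C-absorption : ∀ n k → suc k ℕ.* (suc n C suc k) ≡ suc n ℕ.* (n C k)
  C-absorption zero    zero    = refl
  C-absorption zero    (suc k) = ℕₚ.*-zeroʳ (suc (suc k))
  C-absorption (suc n) zero    =
    trans (ℕₚ.+-identityʳ _) (trans (nC1≡n (suc (suc n))) (sym (ℕₚ.*-identityʳ (suc (suc n)))))
  C-absorption (suc n) (suc k) = begin
      suc (suc k) ℕ.* (suc (suc n) C suc (suc k))
    ≡⟨ cong (suc (suc k) ℕ.*_) (sym (nCk+nC[k+1]≡[n+1]C[k+1] (suc n) (suc k))) ⟩
      suc (suc k) ℕ.* (X ℕ.+ suc n C suc (suc k))
    ≡⟨ ℕₚ.*-distribˡ-+ (suc (suc k)) X _ ⟩
      (X ℕ.+ suc k ℕ.* X) ℕ.+ suc (suc k) ℕ.* (suc n C suc (suc k))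
    ≡⟨ cong₂ (λ a b → (X ℕ.+ a) ℕ.+ b) (C-absorption n k) (C-absorption n (suc k)) ⟩
      (X ℕ.+ suc n ℕ.* (n C k)) ℕ.+ suc n ℕ.* (n C suc k)
    ≡⟨ trans (ℕₚ.+-assoc X _ _) (cong (X ℕ.+_) (sym (ℕₚ.*-distribˡ-+ (suc n) (n C k) (n C suc k)))) ⟩
      X ℕ.+ suc n ℕ.* (n C k ℕ.+ n C suc k)
    ≡⟨ cong (λ y → X ℕ.+ suc n ℕ.* y) (nCk+nC[k+1]≡[n+1]C[k+1] n k) ⟩
      suc (suc n) ℕ.* X ∎
    where
    open ≡-Reasoning
    X : ℕ
    X = suc n C suc k

  ballot : ℕ → ℕ → ℤ
  ballot m zero    = + 1
  ballot m (suc i) = + ((m ℕ.+ i) C suc i) - + ((m ℕ.+ i) C i)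

  ballot-pascal : ∀ m i → ballot m (suc i) + ballot (suc m) i ≡ ballot (suc m) (suc i)
  ballot-pascal m zero = begin
      (+ A - + 1) + + 1     ≡⟨ reassociate (+ A) ⟩
      (+ 1 + + A) - + 1     ≡⟨ cong (_- + 1) (sym (ℤₚ.pos-+ 1 A)) ⟩
      + suc A - + 1         ≡⟨ cong (λ c → + c - + 1) (nCk+nC[k+1]≡[n+1]C[k+1] (m ℕ.+ 0) 0) ⟩
      ballot (suc m) 1 ∎
    where
    open ≡-Reasoning
    A : ℕ
    A = (m ℕ.+ 0) C 1
    reassociate : ∀ x → (x - + 1) + + 1 ≡ (+ 1 + x) - + 1
    reassociate = solve-∀
  ballot-pascal m (suc i) rewrite ℕₚ.+-suc m i = begin
      (+ X₂ - + X₁) + (+ X₁ - + X₀)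
    ≡⟨ regroup (+ X₀) (+ X₁) (+ X₂) ⟩
      (+ X₁ + + X₂) - (+ X₀ + + X₁)
    ≡⟨ cong₂ _-_ (sym (ℤₚ.pos-+ X₁ X₂)) (sym (ℤₚ.pos-+ X₀ X₁)) ⟩
      + (X₁ ℕ.+ X₂) - + (X₀ ℕ.+ X₁)
    ≡⟨ cong₂ (λ a b → + a - + b) (nCk+nC[k+1]≡[n+1]C[k+1] K (suc i)) (nCk+nC[k+1]≡[n+1]C[k+1] K i) ⟩
      + (suc K C suc (suc i)) - + (suc K C suc i) ∎
    where
    open ≡-Reasoning
    K : ℕ
    K = suc (m ℕ.+ i)
    X₀ : ℕ
    X₀ = K C i
    X₁ : ℕ
    X₁ = K C suc i
    X₂ : ℕ
    X₂ = K C suc (suc i)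
    regroup : ∀ x₀ x₁ x₂ → (x₂ - x₁) + (x₁ - x₀) ≡ (x₁ + x₂) - (x₀ + x₁)
    regroup = solve-∀

  ballot-closed : ∀ m i → + (m ℕ.+ i) * ballot m i ≡ (+ m - + i) * + ((m ℕ.+ i) C m)
  ballot-closed m zero = trans (cong (λ k → + k * + 1) (ℕₚ.+-identityʳ m))
    (trans (unit (+ m)) (cong (λ c → (+ m - + 0) * + c) (sym (trans (cong (_C m) (ℕₚ.+-identityʳ m)) (nCn≡1 m)))))
    where
    unit : ∀ x → x * + 1 ≡ (x - + 0) * + 1
    unit = solve-∀
  ballot-closed m (suc i) = begin
      + (m ℕ.+ s) * (+ A₁ - + A₀)
    ≡⟨ cong (_* (+ A₁ - + A₀)) (ℤₚ.pos-+ m s) ⟩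
      (+ m + + s) * (+ A₁ - + A₀)
    ≡⟨ expand (+ m) (+ s) (+ A₀) (+ A₁) ⟩
      (+ m + + s) * (+ A₀ + + A₁) - (+ A₀ * (+ m + + s) + + A₀ * (+ m + + s))
    ≡⟨ cong₂ (λ x y → (+ m + + s) * x - (y + y)) (sym (ℤₚ.pos-+ A₀ A₁)) absorbed ⟩
      (+ m + + s) * + X - (+ s * + X + + s * + X)
    ≡⟨ collect (+ m) (+ s) (+ X) ⟩
      (+ m - + s) * + X
    ≡⟨ cong (λ c → (+ m - + s) * + c) X≡ ⟩
      (+ m - + s) * + ((m ℕ.+ s) C m) ∎
    where
    open ≡-Reasoning
    s : ℕ
    s = suc i
    A₀ : ℕ
    A₀ = (m ℕ.+ i) C i
    A₁ : ℕ
    A₁ = (m ℕ.+ i) C s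
    X : ℕ
    X = A₀ ℕ.+ A₁
    pascal : X ≡ suc (m ℕ.+ i) C s
    pascal = nCk+nC[k+1]≡[n+1]C[k+1] (m ℕ.+ i) i
    X≡ : X ≡ (m ℕ.+ s) C m
    X≡ = trans pascal (trans (cong (_C s) (sym (ℕₚ.+-suc m i))) (sym (C-symmetric m s)))
    absorbedℕ : A₀ ℕ.* (m ℕ.+ s) ≡ s ℕ.* X
    absorbedℕ = begin
        A₀ ℕ.* (m ℕ.+ s)        ≡⟨ cong (A₀ ℕ.*_) (ℕₚ.+-suc m i) ⟩
        A₀ ℕ.* suc (m ℕ.+ i)    ≡⟨ ℕₚ.*-comm A₀ _ ⟩
        suc (m ℕ.+ i) ℕ.* A₀    ≡⟨ sym (C-absorption (m ℕ.+ i) i) ⟩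
        s ℕ.* (suc (m ℕ.+ i) C s) ≡⟨ cong (s ℕ.*_) (sym pascal) ⟩
        s ℕ.* X ∎
    absorbed : + A₀ * (+ m + + s) ≡ + s * + X
    absorbed = trans (cong (+ A₀ *_) (sym (ℤₚ.pos-+ m s)))
                 (trans (sym (ℤₚ.pos-* A₀ (m ℕ.+ s))) (trans (cong +_ absorbedℕ) (ℤₚ.pos-* s X)))
    expand : ∀ m s a₀ a₁ → (m + s) * (a₁ - a₀) ≡ (m + s) * (a₀ + a₁) - (a₀ * (m + s) + a₀ * (m + s))
    expand = solve-∀
    collect : ∀ m s x → (m + s) * x - (s * x + s * x) ≡ (m - s) * x
    collect = solve-∀

  exact-quotient : ∀ b m x → b * + suc m ≡ + x → b ≡ + (x ℕ./ suc m)
  exact-quotient (+ y)    m x eq = cong +_ (sym (trans (cong (ℕ._/ suc m) (sym (ℤₚ.+-injective (trans (ℤₚ.pos-* y (suc m)) eq))))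
                                                       (m*n/n≡m y (suc m))))
  exact-quotient -[1+ y ] m x ()

  -- At i = m the closed form reads (2m + 1) · ballot (m + 1) m = (2m+1 choose m+1), and
  -- absorption turns this into (m + 1) · ballot (m + 1) m = (2m choose m).
  ballot-catalan : ∀ m → ballot (suc m) m ≡ + catalan m
  ballot-catalan m = exact-quotient b m ((m ℕ.+ m) C m) (ℤₚ.*-cancelˡ-≡ (+ suc (m ℕ.+ m)) _ _ scaled)
    where
    b : ℤ
    b = ballot (suc m) m
    C₁ : ℕ
    C₁ = suc (m ℕ.+ m) C suc m
    closed : + suc (m ℕ.+ m) * b ≡ + C₁
    closed = trans (ballot-closed (suc m) m)
               (trans (cong (_* + C₁) (trans (cong (_- + m) (ℤₚ.pos-+ 1 m)) (cancel (+ m)))) (ℤₚ.*-identityˡ (+ C₁)))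
      where
      cancel : ∀ x → (+ 1 + x) - x ≡ + 1
      cancel = solve-∀
    scaled : + suc (m ℕ.+ m) * (b * + suc m) ≡ + suc (m ℕ.+ m) * + ((m ℕ.+ m) C m)
    scaled = begin
        + suc (m ℕ.+ m) * (b * + suc m)     ≡⟨ sym (ℤₚ.*-assoc (+ suc (m ℕ.+ m)) b (+ suc m)) ⟩
        (+ suc (m ℕ.+ m) * b) * + suc m     ≡⟨ cong (_* + suc m) closed ⟩
        + C₁ * + suc m                       ≡⟨ sym (ℤₚ.pos-* C₁ (suc m)) ⟩
        + (C₁ ℕ.* suc m)                     ≡⟨ cong +_ (trans (ℕₚ.*-comm C₁ (suc m)) (C-absorption (m ℕ.+ m) m)) ⟩
        + (suc (m ℕ.+ m) ℕ.* ((m ℕ.+ m) C m)) ≡⟨ ℤₚ.pos-* (suc (m ℕ.+ m)) _ ⟩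
        + suc (m ℕ.+ m) * + ((m ℕ.+ m) C m) ∎
      where open ≡-Reasoning

  ballot-diagonal : ∀ m → ballot (suc m) (suc m) ≡ + 0
  ballot-diagonal m = trans (cong (λ c → + c - + ((suc m ℕ.+ m) C m)) (C-symmetric (suc m) m))
                            (ℤₚ.+-inverseʳ (+ ((suc m ℕ.+ m) C m)))


module HVector where
  open import Data.Nat as ℕ using (ℕ; zero; suc; _∸_; z≤n; s≤s; ⌊_/2⌋)
  import Data.Nat.Properties as ℕₚ
  open import Data.Nat.Combinatorics using (_C_)
  open import Data.Integer using (ℤ; +_; _+_; _-_; _*_)
  import Data.Integer.Properties as ℤₚ
  open import Data.List using (applyUpTo)
  open CircularPeakSets using (pc-suc-zero; pc-pascal; pc-small)
  open Substitution
  open BallotNumbers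

  coeff-map-applyUpTo-< : ∀ (f : ℕ → ℤ) g L {k} → k ℕ.< L → coeff (map f (applyUpTo g L)) k ≡ f (g k)
  coeff-map-applyUpTo-< f g (suc L) {zero}  _         = refl
  coeff-map-applyUpTo-< f g (suc L) {suc k} (s≤s k<L) = coeff-map-applyUpTo-< f (g ∘ suc) L k<L

  coeff-map-applyUpTo-≥ : ∀ (f : ℕ → ℤ) g L {k} → L ℕ.≤ k → coeff (map f (applyUpTo g L)) k ≡ + 0
  coeff-map-applyUpTo-≥ f g zero    _         = refl
  coeff-map-applyUpTo-≥ f g (suc L) (s≤s L≤k) = coeff-map-applyUpTo-≥ f (g ∘ suc) L L≤k

  coeff-fPoly-≤ : ∀ n {D} → d n ≡ D → ∀ {k} → k ℕ.≤ D → coeff (fPoly n) k ≡ + pc n (D ∸ k)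
  coeff-fPoly-≤ n refl k≤D = coeff-map-applyUpTo-< (λ k → + pc n (d n ∸ k)) id (suc (d n)) (s≤s k≤D)

  coeff-fPoly-> : ∀ n {D} → d n ≡ D → ∀ {k} → D ℕ.< k → coeff (fPoly n) k ≡ + 0
  coeff-fPoly-> n refl D<k = coeff-map-applyUpTo-≥ (λ k → + pc n (d n ∸ k)) id (suc (d n)) D<k

  length-fPoly : ∀ n → length (fPoly n) ≡ suc (d n)
  length-fPoly n = trans (length-map _ (upTo (suc (d n)))) (length-upTo (suc (d n)))

  h≡coeff : ∀ n {D} → d n ≡ D → ∀ i → h n i ≡ coeff (hPoly n) (D ∸ i)
  h≡coeff n refl i = refl

  fPoly-pascal : ∀ n {D} → d n ≡ D → D ℕ.+ D ℕ.≤ n → ∀ {k} → k ℕ.≤ D →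
    + pc (suc n) (D ∸ k) ≡ coeff (fPoly n) k + coeff (fPoly n) (suc k)
  fPoly-pascal n {D} dn room {k} k≤D with ℕₚ.m≤n⇒m<n∨m≡n k≤D
  ... | inj₂ refl = begin
      + pc (suc n) (k ∸ k)
    ≡⟨ cong (λ j → + pc (suc n) j) (ℕₚ.n∸n≡0 k) ⟩
      + pc (suc n) 0
    ≡⟨ cong +_ (pc-suc-zero n) ⟩
      + pc n 0
    ≡⟨ sym (ℤₚ.+-identityʳ _) ⟩
      + pc n 0 + + 0
    ≡⟨ sym (cong₂ _+_ (trans (coeff-fPoly-≤ n dn ℕₚ.≤-refl) (cong (λ j → + pc n j) (ℕₚ.n∸n≡0 k)))
                      (coeff-fPoly-> n dn ℕₚ.≤-refl)) ⟩
      coeff (fPoly n) k + coeff (fPoly n) (suc k) ∎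
    where open ≡-Reasoning
  ... | inj₁ k<D = begin
      + pc (suc n) (D ∸ k)
    ≡⟨ cong (λ j → + pc (suc n) j) D∸k ⟩
      + pc (suc n) (suc r)
    ≡⟨ cong +_ (pc-pascal n r fits) ⟩
      + (pc n (suc r) ℕ.+ pc n r)
    ≡⟨ ℤₚ.pos-+ (pc n (suc r)) (pc n r) ⟩
      + pc n (suc r) + + pc n r
    ≡⟨ sym (cong₂ _+_ (trans (coeff-fPoly-≤ n dn k≤D) (cong (λ j → + pc n j) D∸k)) (coeff-fPoly-≤ n dn k<D)) ⟩
      coeff (fPoly n) k + coeff (fPoly n) (suc k) ∎
    where
    open ≡-Reasoning
    r : ℕ
    r = D ∸ suc k
    D∸k : D ∸ k ≡ suc r
    D∸k = ℕₚ.+-∸-assoc 1 k<D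
    r<D : suc r ℕ.≤ D
    r<D = subst (ℕ._≤ D) D∸k (ℕₚ.m∸n≤m D k)
    fits : suc (suc (suc (r ℕ.+ r))) ℕ.≤ suc n
    fits = s≤s (subst (ℕ._≤ n) (cong suc (ℕₚ.+-suc r r)) (ℕₚ.≤-trans (ℕₚ.+-mono-≤ r<D r<D) room))

  ⌊1+n+n/2⌋≡n : ∀ m → ⌊ suc (m ℕ.+ m) /2⌋ ≡ m
  ⌊1+n+n/2⌋≡n zero    = refl
  ⌊1+n+n/2⌋≡n (suc m) = cong suc (trans (cong ⌊_/2⌋ (ℕₚ.+-suc m m)) (⌊1+n+n/2⌋≡n m))

  ⌊n+n/2⌋≡n : ∀ m → ⌊ m ℕ.+ m /2⌋ ≡ m
  ⌊n+n/2⌋≡n m = sym (ℕₚ.n≡⌊n+n/2⌋ m)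

  data Parity : ℕ → Set where
    odd  : ∀ m → Parity (suc (m ℕ.+ m))
    even : ∀ m → Parity (suc (suc (m ℕ.+ m)))

  parity : ∀ n → Parity (suc n)
  parity zero = odd 0
  parity (suc n) with parity n
  ... | odd m  = even m
  ... | even m = subst Parity (cong (suc ∘ suc) (ℕₚ.+-suc m m)) (odd (suc m))

  module OddStep (m : ℕ) where
    n : ℕ
    n = suc (m ℕ.+ m)

    d-n : d n ≡ m
    d-n = ⌊n+n/2⌋≡n m

    d-suc-n : d (suc n) ≡ m
    d-suc-n = ⌊1+n+n/2⌋≡n m

    fPoly-suc : ∀ k → coeff (fPoly (suc n)) k ≡ coeff (fPoly n) k + coeff (fPoly n) (suc k)
    fPoly-suc k with ℕₚ.≤-<-connex k m
    ... | inj₁ k≤m = trans (coeff-fPoly-≤ (suc n) d-suc-n k≤m) (fPoly-pascal n d-n (ℕₚ.n≤1+n _) k≤m)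
    ... | inj₂ m<k = trans (coeff-fPoly-> (suc n) d-suc-n m<k)
      (sym (cong₂ _+_ (coeff-fPoly-> n d-n m<k) (coeff-fPoly-> n d-n (ℕₚ.m<n⇒m<1+n m<k))))

    hPoly-suc : ∀ k → coeff (hPoly (suc n)) k ≡ coeff (hPoly n) k + coeff (hPoly (suc n)) (suc k)
    hPoly-suc = substXm1-pascal (fPoly n) (fPoly (suc n)) fPoly-suc

    h-suc-zero : h (suc n) 0 ≡ h n 0
    h-suc-zero = begin
        coeff (hPoly (suc n)) (d (suc n))
      ≡⟨ cong (coeff (hPoly (suc n))) d-suc-n ⟩
        coeff (hPoly (suc n)) m
      ≡⟨ hPoly-suc m ⟩
        coeff (hPoly n) m + coeff (hPoly (suc n)) (suc m)
      ≡⟨ cong (λ x → coeff (hPoly n) m + x)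
           (coeff-substXm1-≥ (fPoly (suc n)) (ℕₚ.≤-reflexive (trans (length-fPoly (suc n)) (cong suc d-suc-n)))) ⟩
        coeff (hPoly n) m + + 0
      ≡⟨ trans (ℤₚ.+-identityʳ _) (sym (cong (coeff (hPoly n)) d-n)) ⟩
        coeff (hPoly n) (d n) ∎
      where open ≡-Reasoning

    h-suc-suc : ∀ i → i ℕ.< m → h (suc n) (suc i) ≡ h n (suc i) + h (suc n) i
    h-suc-suc i i<m = begin
        h (suc n) (suc i)
      ≡⟨ h≡coeff (suc n) d-suc-n (suc i) ⟩
        coeff (hPoly (suc n)) (m ∸ suc i)
      ≡⟨ hPoly-suc (m ∸ suc i) ⟩
        coeff (hPoly n) (m ∸ suc i) + coeff (hPoly (suc n)) (suc (m ∸ suc i))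
      ≡⟨ cong₂ _+_ (sym (h≡coeff n d-n (suc i)))
           (trans (cong (coeff (hPoly (suc n))) (sym (ℕₚ.+-∸-assoc 1 i<m))) (sym (h≡coeff (suc n) d-suc-n i))) ⟩
        h n (suc i) + h (suc n) i ∎
      where open ≡-Reasoning

  module EvenStep (m : ℕ) where
    n : ℕ
    n = suc (suc (m ℕ.+ m))

    d-n : d n ≡ m
    d-n = ⌊1+n+n/2⌋≡n m

    d-suc-n : d (suc n) ≡ suc m
    d-suc-n = cong suc (⌊n+n/2⌋≡n m)

    fPoly-suc-zero : coeff (fPoly (suc n)) 0 ≡ coeff (fPoly n) 0
    fPoly-suc-zero = begin
        coeff (fPoly (suc n)) 0
      ≡⟨ coeff-fPoly-≤ (suc n) d-suc-n z≤n ⟩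
        + pc (suc n) (suc m)
      ≡⟨ cong +_ (pc-pascal n m ℕₚ.≤-refl) ⟩
        + (pc n (suc m) ℕ.+ pc n m)
      ≡⟨ cong (λ c → + (c ℕ.+ pc n m)) (pc-small n m (ℕₚ.n<1+n n)) ⟩
        + pc n m
      ≡⟨ sym (coeff-fPoly-≤ n d-n z≤n) ⟩
        coeff (fPoly n) 0 ∎
      where open ≡-Reasoning

    fPoly-suc-suc : ∀ k → coeff (fPoly (suc n)) (suc k) ≡ coeff (fPoly n) k + coeff (fPoly n) (suc k)
    fPoly-suc-suc k with ℕₚ.≤-<-connex k m
    ... | inj₁ k≤m = trans (coeff-fPoly-≤ (suc n) d-suc-n (s≤s k≤m))
                           (fPoly-pascal n d-n (ℕₚ.≤-trans (ℕₚ.n≤1+n _) (ℕₚ.n≤1+n _)) k≤m)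
    ... | inj₂ m<k = trans (coeff-fPoly-> (suc n) d-suc-n (s≤s m<k))
      (sym (cong₂ _+_ (coeff-fPoly-> n d-n m<k) (coeff-fPoly-> n d-n (ℕₚ.m<n⇒m<1+n m<k))))

    hPoly-suc : coeff (hPoly (suc n)) 0 ≡ + 0 × (∀ k → coeff (hPoly (suc n)) (suc k) ≡ coeff (hPoly n) k)
    hPoly-suc = substXm1-times-1+x (fPoly n) (fPoly (suc n)) fPoly-suc-zero fPoly-suc-suc

    h-suc-≤ : ∀ i → i ℕ.≤ m → h (suc n) i ≡ h n i
    h-suc-≤ i i≤m = begin
        h (suc n) i
      ≡⟨ h≡coeff (suc n) d-suc-n i ⟩
        coeff (hPoly (suc n)) (suc m ∸ i)
      ≡⟨ cong (coeff (hPoly (suc n))) (ℕₚ.+-∸-assoc 1 i≤m) ⟩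
        coeff (hPoly (suc n)) (suc (m ∸ i))
      ≡⟨ proj₂ hPoly-suc (m ∸ i) ⟩
        coeff (hPoly n) (m ∸ i)
      ≡⟨ sym (h≡coeff n d-n i) ⟩
        h n i ∎
      where open ≡-Reasoning

    h-suc-top : h (suc n) (suc m) ≡ + 0
    h-suc-top = trans (h≡coeff (suc n) d-suc-n (suc m))
                      (trans (cong (coeff (hPoly (suc n))) (ℕₚ.n∸n≡0 m)) (proj₁ hPoly-suc))

  HasBallotForm : ℕ → Set
  HasBallotForm n = ∀ i → i ℕ.≤ d n → h n i ≡ ballot ⌊ n /2⌋ i

  ballotForm-step : ∀ n → Parity (suc n) → HasBallotForm (suc n) → HasBallotForm (suc (suc n))
  ballotForm-step _ (odd m) IH i i≤ =
    trans (ballot-odd i (subst (i ℕ.≤_) d-suc-n i≤)) (cong (λ k → ballot (suc k) i) (sym (⌊n+n/2⌋≡n m)))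
    where
    open OddStep m
    ballot-odd : ∀ i → i ℕ.≤ m → h (suc n) i ≡ ballot (suc m) i
    ballot-odd zero    _    = trans h-suc-zero (IH 0 z≤n)
    ballot-odd (suc i) i<m = begin
        h (suc n) (suc i)
      ≡⟨ h-suc-suc i i<m ⟩
        h n (suc i) + h (suc n) i
      ≡⟨ cong₂ _+_ (trans (IH (suc i) (subst (suc i ℕ.≤_) (sym d-n) i<m)) (cong (λ k → ballot k (suc i)) (⌊1+n+n/2⌋≡n m)))
                   (ballot-odd i (ℕₚ.<⇒≤ i<m)) ⟩
        ballot m (suc i) + ballot (suc m) i
      ≡⟨ ballot-pascal m i ⟩
        ballot (suc m) (suc i) ∎
      where open ≡-Reasoning
  ballotForm-step _ (even m) IH i i≤ =
    trans (ballot-even i (subst (i ℕ.≤_) d-suc-n i≤)) (cong (λ k → ballot (suc k) i) (sym (⌊1+n+n/2⌋≡n m)))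
    where
    open EvenStep m
    ballot-even : ∀ i → i ℕ.≤ suc m → h (suc n) i ≡ ballot (suc m) i
    ballot-even i i≤ with ℕₚ.m≤n⇒m<n∨m≡n i≤
    ... | inj₁ (s≤s i≤m) = trans (h-suc-≤ i i≤m)
            (trans (IH i (subst (i ℕ.≤_) (sym d-n) i≤m)) (cong (λ k → ballot (suc k) i) (⌊n+n/2⌋≡n m)))
    ... | inj₂ refl = trans h-suc-top (sym (ballot-diagonal m))

  ballotForm : ∀ n → HasBallotForm (suc n)
  ballotForm zero    zero    _ = refl
  ballotForm (suc n) = ballotForm-step n (parity n) (ballotForm n)

  h-closed-form : ∀ n → 1 ℕ.≤ n → ∀ i → i ℕ.≤ d n →
    + (⌊ n /2⌋ ℕ.+ i) * h n i ≡ (+ ⌊ n /2⌋ - + i) * + ((⌊ n /2⌋ ℕ.+ i) C ⌊ n /2⌋)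
  h-closed-form (suc n) _ i i≤ =
    trans (cong (+ (⌊ suc n /2⌋ ℕ.+ i) *_) (ballotForm n i i≤)) (ballot-closed ⌊ suc n /2⌋ i)

  ε-even : ∀ m → ε (m ℕ.+ m) ≡ + 0
  ε-even zero    = refl
  ε-even (suc m) = trans (cong (ε ∘ suc) (ℕₚ.+-suc m m)) (ε-even m)

  ε-odd : ∀ m → ε (suc (m ℕ.+ m)) ≡ + 1
  ε-odd zero    = refl
  ε-odd (suc m) = trans (cong (ε ∘ suc ∘ suc) (ℕₚ.+-suc m m)) (ε-odd m)

  RecurrenceAt : ℕ → ℕ → Set
  RecurrenceAt n n₊₁ =
    (h n₊₁ 0 ≡ h n 0)
    × ((i : ℕ) → 1 ℕ.≤ i → i ℕ.≤ ⌊ n /2⌋ ∸ 1 → h n₊₁ i ≡ h n i + ε n * h n₊₁ (i ∸ 1))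
    × (h n₊₁ ⌊ n /2⌋ ≡ ε n * + catalan ⌊ n /2⌋)

  recurrence : ∀ n → Parity n → RecurrenceAt n (suc n)
  recurrence _ (odd m) = h-suc-zero , middle , top
    where
    open OddStep m
    middle : (i : ℕ) → 1 ℕ.≤ i → i ℕ.≤ ⌊ n /2⌋ ∸ 1 → h (suc n) i ≡ h n i + ε n * h (suc n) (i ∸ 1)
    middle (suc i) _ i< = trans (h-suc-suc i i<m)
      (cong (λ x → h n (suc i) + x) (sym (trans (cong (_* h (suc n) i) (ε-odd m)) (ℤₚ.*-identityˡ _))))
      where
      i<m : i ℕ.< m
      i<m = ℕₚ.≤-trans (subst (λ k → suc i ℕ.≤ k ∸ 1) (⌊1+n+n/2⌋≡n m) i<) (ℕₚ.m∸n≤m m 1)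
    top : h (suc n) ⌊ n /2⌋ ≡ ε n * + catalan ⌊ n /2⌋
    top = begin
        h (suc n) ⌊ n /2⌋
      ≡⟨ cong (h (suc n)) (⌊1+n+n/2⌋≡n m) ⟩
        h (suc n) m
      ≡⟨ ballotForm n m (ℕₚ.≤-reflexive (sym d-suc-n)) ⟩
        ballot (suc ⌊ m ℕ.+ m /2⌋) m
      ≡⟨ cong (λ k → ballot (suc k) m) (⌊n+n/2⌋≡n m) ⟩
        ballot (suc m) m
      ≡⟨ ballot-catalan m ⟩
        + catalan m
      ≡⟨ sym (ℤₚ.*-identityˡ _) ⟩
        + 1 * + catalan m
      ≡⟨ sym (cong₂ (λ e k → e * + catalan k) (ε-odd m) (⌊1+n+n/2⌋≡n m)) ⟩
        ε n * + catalan ⌊ n /2⌋ ∎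
      where open ≡-Reasoning
  recurrence _ (even m) = h-suc-≤ 0 z≤n , middle , top
    where
    open EvenStep m
    vanishes : ∀ x → ε n * x ≡ + 0
    vanishes x = trans (cong (_* x) (ε-even m)) (ℤₚ.*-zeroˡ x)
    middle : (i : ℕ) → 1 ℕ.≤ i → i ℕ.≤ ⌊ n /2⌋ ∸ 1 → h (suc n) i ≡ h n i + ε n * h (suc n) (i ∸ 1)
    middle i _ i≤ = trans (h-suc-≤ i (subst (i ℕ.≤_) (⌊n+n/2⌋≡n m) i≤))
                          (sym (trans (cong (λ x → h n i + x) (vanishes _)) (ℤₚ.+-identityʳ _)))
    top : h (suc n) ⌊ n /2⌋ ≡ ε n * + catalan ⌊ n /2⌋
    top = trans (cong (λ k → h (suc n) (suc k)) (⌊n+n/2⌋≡n m)) (trans h-suc-top (sym (vanishes _)))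

  h-recurrence : ∀ n → 1 ℕ.≤ n → RecurrenceAt n (n ℕ.+ 1)
  h-recurrence (suc n) _ = subst (RecurrenceAt (suc n)) (ℕₚ.+-comm 1 (suc n)) (recurrence (suc n) (parity n))

open import Data.Nat using (ℕ; _+_; _∸_; _≤_; ⌊_/2⌋; s≤s; z≤n)
open import Data.Nat.Properties using (≤-trans)
open import Data.Nat.Combinatorics using (_C_)
open import Data.Integer as ℤ using (ℤ; +_)
open HVector using (h-recurrence; h-closed-form)

corollary3p8 :
    ((n : ℕ) → 3 ≤ n →
      (h (n + 1) 0 ≡ h n 0)
      × ((i : ℕ) → 1 ≤ i → i ≤ ⌊ n /2⌋ ∸ 1 →
           h (n + 1) i ≡ h n i ℤ.+ ε n ℤ.* h (n + 1) (i ∸ 1))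
      × (h (n + 1) ⌊ n /2⌋ ≡ ε n ℤ.* + catalan ⌊ n /2⌋))
    × (h 3 0 ≡ + 1 × h 3 1 ≡ + 0)
    × ((n : ℕ) → 3 ≤ n → (i : ℕ) → i ≤ d n →
         + (⌊ n /2⌋ + i) ℤ.* h n i ≡ (+ ⌊ n /2⌋ ℤ.- + i) ℤ.* + ((⌊ n /2⌋ + i) C ⌊ n /2⌋))
corollary3p8 =
    (λ n 3≤n → h-recurrence n (positive 3≤n))
  , (refl , refl)
  , (λ n 3≤n → h-closed-form n (positive 3≤n))
  where
  positive : ∀ {n} → 3 ≤ n → 1 ≤ n
  positive = ≤-trans (s≤s z≤n)
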